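{- Let $q\ge5$. (i) The union of the $q+1$ osculating planes and the $q^2+q$ $2_{\mathcal{C}}$-planes can be partitioned into $q+1$ pencils of planes such that each pencil consists of one osculating plane and $q$ $2_{\mathcal{C}}$-planes, and the axis of each pencil is a tangent to $\mathcal{C}$. (ii) Among EnG-lines, only lines lying in $2_{\mathcal{C}}$-planes can intersect tangents to $\mathcal{C}$. If $q\not\equiv0\pmod 3$, EnG-lines lying in $2_{\mathcal{C}}$-planes intersect tangents in $T$-points; if $q\equiv0\pmod3$, they intersect tangents in $TO$-points. (iii) For every EnG-line $\ell$, $\mathrm{P}_T(\ell)=\Pi_{2_{\mathcal{C}}}(\ell)$ if $q\not\equiv0\pmod3$, and $\mathrm{P}_{TO}(\ell)=\Pi_{2_{\mathcal{C}}}(\ell)$ if $q\equiv0\pmod3$.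
   Context: $\mathbf{P}(x_0,\dots,x_3)$ is a point of $\mathrm{PG}(3,q)$, $\boldsymbol{\pi}(c_0,\dots,c_3)$ the plane $\sum c_ix_i=0$. Twisted cubic $\mathcal{C}=\{\mathbf{P}(t^3,t^2,t,1):t\in\mathbb{F}_q\}\cup\{\mathbf{P}(1,0,0,0)\}$. Osculating planes: $\boldsymbol{\pi}(1,-3t,3t^2,-t^3)$, $t\in\mathbb{F}_q$, and $\boldsymbol{\pi}(0,0,0,1)$. The tangent at $\mathbf{P}(t^3,t^2,t,1)$ is the line through it and $\mathbf{P}(3t^2,2t,1,0)$; at $\mathbf{P}(1,0,0,0)$ it is the line through it and $\mathbf{P}(0,1,0,0)$. An EnG-line is a line containing no point of $\mathcal{C}$, not contained in an osculating plane, and which is neither a real chord, an imaginary chord (line joining two conjugate points of $\mathcal{C}$ over $\mathbb{F}_{q^2}$), a tangent, nor an axis (intersection of two distinct real, or two conjugate, osculating planes). A $2_{\mathcal{C}}$-plane is a plane containing exactly two points of $\mathcal{C}$. For $q\not\equiv0\pmod3$, a $T$-point is a point off $\mathcal{C}$ on a tangent; for $q\equiv 0\pmod 3$, a $TO$-point is a point off $\mathcal{C}$ on a tangent lying in exactly one osculating plane. For a line $\ell$, $\Pi_{2_{\mathcal{C}}}(\ell)$ is the number of $2_{\mathcal{C}}$-planes through $\ell$, and $\mathrm{P}_\kappa(\ell)$ the number of $\kappa$-points on $\ell$. -}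

module Defs where

open import Level using (0ℓ)
open import Data.Nat as ℕ using (ℕ; zero; suc)
open import Data.List.Base using (List; length; filter; cartesianProduct)
open import Data.List.Membership.Propositional using (_∈_)
open import Data.List.Relation.Unary.Unique.Propositional using (Unique)
open import Data.List.Relation.Unary.Any as Any using (Any; any?)
open import Data.Product using (Σ; ∃; _×_; _,_; proj₁; proj₂)
open import Data.Product.Properties using (≡-dec)
open import Data.Sum using (_⊎_; inj₁; inj₂)
open import Relation.Nullary using (Dec; yes; no; ¬_)
open import Relation.Nullary.Decidable using (_×-dec_; _⊎-dec_; ¬?)
open import Relation.Unary using (Pred; Decidable)
open import Relation.Binary.Definitions using (DecidableEquality)
open import Relation.Binary.PropositionalEquality using (_≡_; _≢_; subst)
open import Algebra.Structures using (IsCommutativeRing)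

record FiniteField : Set₁ where
  infixl 6 _+_
  infixl 7 _*_
  field
    Carrier : Set
    _+_ _*_ : Carrier → Carrier → Carrier
    -_      : Carrier → Carrier
    0# 1#   : Carrier
    isCommutativeRing : IsCommutativeRing _≡_ _+_ _*_ -_ 0# 1#
    0≢1     : 0# ≢ 1#
    inverse : ∀ x → x ≢ 0# → ∃ λ y → x * y ≡ 1#
    _≟_     : DecidableEquality Carrier
    elems   : List Carrier
    complete : ∀ x → x ∈ elems
    unique  : Unique elems

q : FiniteField → ℕ
q F = length (FiniteField.elems F)

module Geom (F : FiniteField) where
  open FiniteField F

  ∃? : {P : Pred Carrier 0ℓ} → Decidable P → Dec (∃ P)
  ∃? {P} P? with any? P? elems
  ... | yes a = yes (Any.satisfied a)
  ... | no ¬a = no λ { (x , px) → ¬a (Any.map (λ eq → subst P eq px) (complete x)) }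

  -- vectors of F^4 (homogeneous coordinates of points and of planes)
  V : Set
  V = Carrier × Carrier × Carrier × Carrier

  _≟V_ : DecidableEquality V
  _≟V_ = ≡-dec _≟_ (≡-dec _≟_ (≡-dec _≟_ _≟_))

  𝟎v : V
  𝟎v = 0# , 0# , 0# , 0#

  _⊕_ : V → V → V
  (a , b , c , d) ⊕ (a' , b' , c' , d') = a + a' , b + b' , c + c' , d + d'

  _⊙_ : Carrier → V → V
  k ⊙ (a , b , c , d) = k * a , k * b , k * c , k * d

  -- the plane with coordinates c contains the point x iff Σ cᵢ xᵢ = 0
  dot : V → V → Carrier
  dot (a , b , c , d) (a' , b' , c' , d') = a * a' + b * b' + c * c' + d * d'

  2# 3# : Carrier
  2# = 1# + 1#
  3# = 1# + 1# + 1#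

  Proj : V → V → Set
  Proj X Y = ∃ λ k → k ≢ 0# × X ≡ k ⊙ Y

  Proj? : ∀ X Y → Dec (Proj X Y)
  Proj? X Y = ∃? (λ k → ¬? (k ≟ 0#) ×-dec (X ≟V (k ⊙ Y)))

  curvePt : Carrier → V
  curvePt t = t * t * t , t * t , t , 1#

  curveInf : V
  curveInf = 1# , 0# , 0# , 0#

  InC : V → Set
  InC X = (∃ λ t → Proj X (curvePt t)) ⊎ Proj X curveInf

  InC? : ∀ X → Dec (InC X)
  InC? X = ∃? (λ t → Proj? X (curvePt t)) ⊎-dec Proj? X curveInf

  -- second points of the tangent lines
  tangentDir : Carrier → V
  tangentDir t = 3# * t * t , 2# * t , 1# , 0#

  tangentDirInf : V
  tangentDirInf = 0# , 1# , 0# , 0#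

  oscPl : Carrier → V
  oscPl t = 1# , - (3# * t) , 3# * t * t , - (t * t * t)

  oscInf : V
  oscInf = 0# , 0# , 0# , 1#

  IsOsc : V → Set
  IsOsc c = (∃ λ t → Proj c (oscPl t)) ⊎ Proj c oscInf

  IsOsc? : ∀ c → Dec (IsOsc c)
  IsOsc? c = ∃? (λ t → Proj? c (oscPl t)) ⊎-dec Proj? c oscInf

  -- lines: spanned by two linearly independent vectors A, B
  Independent : V → V → Set
  Independent A B = ∀ k m → (k ⊙ A) ⊕ (m ⊙ B) ≡ 𝟎v → k ≡ 0# × m ≡ 0#

  OnLine : V → V → V → Set
  OnLine X A B = ∃ λ k → ∃ λ m → X ≡ (k ⊙ A) ⊕ (m ⊙ B)

  OnLine? : ∀ X A B → Dec (OnLine X A B)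
  OnLine? X A B = ∃? (λ k → ∃? (λ m → X ≟V ((k ⊙ A) ⊕ (m ⊙ B))))

  OnPlane : V → V → Set
  OnPlane X c = dot c X ≡ 0#

  OnPlane? : ∀ X c → Dec (OnPlane X c)
  OnPlane? X c = dot c X ≟ 0#

  LineInPlane : V → V → V → Set
  LineInPlane A B c = OnPlane A c × OnPlane B c

  LineInPlane? : ∀ A B c → Dec (LineInPlane A B c)
  LineInPlane? A B c = OnPlane? A c ×-dec OnPlane? B c

  -- normalized representatives: first nonzero coordinate equals 1;
  -- these enumerate the points (resp. planes) of PG(3,q) bijectively
  Normalized : V → Set
  Normalized (a , b , c , d) =
    a ≡ 1# ⊎ (a ≡ 0# × b ≡ 1#) ⊎ (a ≡ 0# × b ≡ 0# × c ≡ 1#)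
      ⊎ (a ≡ 0# × b ≡ 0# × c ≡ 0# × d ≡ 1#)

  Normalized? : ∀ X → Dec (Normalized X)
  Normalized? (a , b , c , d) =
    (a ≟ 1#) ⊎-dec ((a ≟ 0#) ×-dec (b ≟ 1#)) ⊎-dec ((a ≟ 0#) ×-dec (b ≟ 0#) ×-dec (c ≟ 1#))
      ⊎-dec ((a ≟ 0#) ×-dec (b ≟ 0#) ×-dec (c ≟ 0#) ×-dec (d ≟ 1#))

  allVecs : List V
  allVecs = cartesianProduct elems (cartesianProduct elems (cartesianProduct elems elems))

  -- all points of PG(3,q) (equivalently, all planes, by duality of coordinates)
  points : List V
  points = filter Normalized? allVecs

  nCOnPlane : V → ℕ
  nCOnPlane c = length (filter (λ X → OnPlane? X c ×-dec InC? X) points)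

  Two-C : V → Set
  Two-C c = nCOnPlane c ≡ 2

  Two-C? : ∀ c → Dec (Two-C c)
  Two-C? c = nCOnPlane c ℕ.≟ 2

  nOscThroughPt : V → ℕ
  nOscThroughPt X = length (filter (λ c → IsOsc? c ×-dec OnPlane? X c) points)

  OnTangent : V → Set
  OnTangent X = (∃ λ t → OnLine X (curvePt t) (tangentDir t)) ⊎ OnLine X curveInf tangentDirInf

  OnTangent? : ∀ X → Dec (OnTangent X)
  OnTangent? X = ∃? (λ t → OnLine? X (curvePt t) (tangentDir t)) ⊎-dec OnLine? X curveInf tangentDirInf

  TPoint : V → Set
  TPoint X = X ≢ 𝟎v × ¬ InC X × OnTangent X

  TPoint? : ∀ X → Dec (TPoint X)
  TPoint? X = ¬? (X ≟V 𝟎v) ×-dec ¬? (InC? X) ×-dec OnTangent? X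

  TOPoint : V → Set
  TOPoint X = TPoint X × nOscThroughPt X ≡ 1

  TOPoint? : ∀ X → Dec (TOPoint X)
  TOPoint? X = TPoint? X ×-dec (nOscThroughPt X ℕ.≟ 1)

  P-T : V → V → ℕ
  P-T A B = length (filter (λ X → OnLine? X A B ×-dec TPoint? X) points)

  P-TO : V → V → ℕ
  P-TO A B = length (filter (λ X → OnLine? X A B ×-dec TOPoint? X) points)

  Π-2C : V → V → ℕ
  Π-2C A B = length (filter (λ c → LineInPlane? A B c ×-dec Two-C? c) points)

  Π-osc : V → V → ℕ
  Π-osc A B = length (filter (λ c → LineInPlane? A B c ×-dec IsOsc? c) points)

  MeetsC : V → V → Set
  MeetsC A B = ∃ λ X → InC X × OnLine X A B

  InOscPlane : V → V → Set
  InOscPlane A B = ∃ λ c → IsOsc c × LineInPlane A B c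

  RealChord : V → V → Set
  RealChord A B = ∃ λ X → ∃ λ Y → InC X × InC Y × ¬ Proj X Y × OnLine X A B × OnLine Y A B

  IsTangent : V → V → Set
  IsTangent A B = (∃ λ t → OnLine (curvePt t) A B × OnLine (tangentDir t) A B)
                ⊎ (OnLine curveInf A B × OnLine tangentDirInf A B)

  RealAxis : V → V → Set
  RealAxis A B = ∃ λ c → ∃ λ d → IsOsc c × IsOsc d × ¬ Proj c d × LineInPlane A B c × LineInPlane A B d

-- A quadratic extension F_{q^2} of F, needed for imaginary chords and
-- imaginary axes.

record QuadExt (F : FiniteField) : Set₁ where
  open FiniteField F using () renaming (Carrier to K; _+_ to _+F_; _*_ to _*F_; 0# to 0F; 1# to 1F)
  field
    E : FiniteField
  open FiniteField E using () renaming (Carrier to L; _+_ to _+E_; _*_ to _*E_; 0# to 0E; 1# to 1E)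
  field
    ι     : K → L
    ι-0   : ι 0F ≡ 0E
    ι-1   : ι 1F ≡ 1E
    ι-+   : ∀ x y → ι (x +F y) ≡ ι x +E ι y
    ι-*   : ∀ x y → ι (x *F y) ≡ ι x *E ι y
    ι-inj : ∀ x y → ι x ≡ ι y → x ≡ y
    card  : q E ≡ q F ℕ.* q F

module ExtGeom {F : FiniteField} (Ext : QuadExt F) where
  open QuadExt Ext
  module GF = Geom F
  module GE = Geom E
  open FiniteField E using () renaming (Carrier to L; _*_ to _*E_; 1# to 1E)

  _^E_ : L → ℕ → L
  x ^E zero = 1E
  x ^E suc n = x *E (x ^E n)

  conj : L → L
  conj x = x ^E q F

  ιv : GF.V → GE.V
  ιv (a , b , c , d) = ι a , ι b , ι c , ι d

  NotInF : L → Set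
  NotInF τ = ¬ (∃ λ a → τ ≡ ι a)

  ImagChord : GF.V → GF.V → Set
  ImagChord A B = ∃ λ τ → NotInF τ × GE.OnLine (GE.curvePt τ) (ιv A) (ιv B)
                                     × GE.OnLine (GE.curvePt (conj τ)) (ιv A) (ιv B)

  ImagAxis : GF.V → GF.V → Set
  ImagAxis A B = ∃ λ τ → NotInF τ × GE.LineInPlane (ιv A) (ιv B) (GE.oscPl τ)
                                   × GE.LineInPlane (ιv A) (ιv B) (GE.oscPl (conj τ))

  EnG : GF.V → GF.V → Set
  EnG A B = ¬ GF.MeetsC A B × ¬ GF.InOscPlane A B × ¬ GF.RealChord A B × ¬ ImagChord A B
          × ¬ GF.IsTangent A B × ¬ GF.RealAxis A B × ¬ ImagAxis A B

-- Parametrise C by the projective line. The planes through the tangent at t form a pencil, and such a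
-- plane meets C in the parameters s with (s − t)² (l s + m) = 0: it is the osculating plane if l s + m
-- vanishes at t and a 2_C-plane otherwise. Conversely, by Vieta's formulas a plane meeting C in exactly two
-- points contains the tangent at one of them, and a plane contains at most one tangent; this is (i).
-- For a line ℓ meeting neither C nor an osculating plane, the plane spanned by ℓ and a tangent it meets
-- lies in that pencil and is not osculating, hence is a 2_C-plane; since a point off C lies on at most one
-- tangent, this is a bijection between the T-points of ℓ and the 2_C-planes through ℓ, giving (ii) and (iii).
-- In characteristic 3 all tangents meet the line x₀ = x₃ = 0, and every plane through that line is
-- osculating because cubing is bijective; so a T-point of ℓ lies on exactly one osculating plane.
module Submission where

open import Defs
open import Level using (0ℓ)
open import Algebra.Bundles using (CommutativeRing)
open import Data.Nat as ℕ using (ℕ; zero; suc; _≤_; z≤n; s≤s; _%_)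
import Data.Nat.Properties as ℕ
open import Data.Nat.Divisibility using (_∣_; divides; ∣m+n∣m⇒∣n; ∣1⇒≡1; m%n≡0⇒n∣m; ∣m⇒∣m*n)
open import Data.Integer as ℤ using (ℤ; -[1+_])
import Data.Integer.Properties as ℤ
open import Data.Sign as Sign using (Sign)
open import Data.Maybe using (Maybe; just; nothing)
open import Data.Fin as Fin using (Fin)
open import Data.Product using (Σ; ∃; _×_; _,_; proj₁; proj₂)
open import Data.Product.Properties using (≡-dec)
open import Data.Sum using (_⊎_; inj₁; inj₂; [_,_]′)
open import Data.Empty using (⊥; ⊥-elim)
open import Data.List.Base using (List; []; _∷_; length; filter; map; lookup; allFin; cartesianProduct)
open import Data.List.Properties using (filter-notAll; filter-≐; length-++; length-map; length-tabulate)
open import Data.List.Membership.Propositional using (_∈_)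
open import Data.List.Membership.Propositional.Properties
  using (∈-filter⁺; ∈-filter⁻; ∈-map⁺; ∈-map⁻; ∈-lookup; ∈-allFin; ∈-cartesianProduct⁺)
open import Data.List.Relation.Unary.Any as Any using (Any; here; there)
open import Data.List.Relation.Unary.Any.Properties using (lookup-index)
open import Data.List.Relation.Unary.All as All using (All; []; _∷_)
open import Data.List.Relation.Unary.AllPairs using ([]; _∷_)
open import Data.List.Relation.Unary.Unique.Propositional using (Unique)
import Data.List.Relation.Unary.Unique.Propositional.Properties as Unique
open import Relation.Nullary using (Dec; yes; no; ¬_)
open import Relation.Nullary.Decidable using (¬?; _×-dec_)
open import Relation.Unary using (Pred; Decidable)
open import Relation.Binary.Definitions using (DecidableEquality)
import Relation.Binary.PropositionalEquality as ≡

-- The ring solver over an arbitrary commutative ring, with integer coefficients so that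
-- identities involving the numerals 2 and 3 are normalised.
module IntegerCoefficients {c ℓ} (R : CommutativeRing c ℓ) where
  open CommutativeRing R
  open import Algebra.Properties.Ring ring using (-1*x≈-x)
  open import Algebra.Properties.Group +-group using (ε⁻¹≈ε; ⁻¹-involutive)
  open import Algebra.Properties.AbelianGroup +-abelianGroup using (⁻¹-∙-comm)
  open import Algebra.Properties.CommutativeSemigroup +-commutativeSemigroup
    using () renaming (interchange to +-interchange)
  open import Algebra.Properties.CommutativeSemigroup *-commutativeSemigroup
    using () renaming (interchange to *-interchange)
  open import Algebra.Properties.Monoid.Mult +-monoid using (×-homo-+) renaming (_×_ to _×′_)
  open import Algebra.Properties.Semiring.Mult semiring using (×1-homo-*)
  open import Algebra.Solver.Ring.AlmostCommutativeRing
    using (_-Raw-AlmostCommutative⟶_; fromCommutativeRing)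
  open import Relation.Binary.Reasoning.Setoid setoid

  -- Chosen so that fromℕ 2 and fromℕ 3 are literally 1# + 1# and 1# + 1# + 1#.
  fromℕ : ℕ → Carrier
  fromℕ zero = 0#
  fromℕ (suc zero) = 1#
  fromℕ (suc (suc n)) = fromℕ (suc n) + 1#

  fromℕ≈×1# : ∀ n → fromℕ n ≈ n ×′ 1#
  fromℕ≈×1# zero = refl
  fromℕ≈×1# (suc zero) = sym (+-identityʳ 1#)
  fromℕ≈×1# (suc (suc n)) = trans (+-congʳ (fromℕ≈×1# (suc n))) (+-comm _ 1#)

  fromℕ-+ : ∀ m n → fromℕ (m ℕ.+ n) ≈ fromℕ m + fromℕ n
  fromℕ-+ m n = begin
    fromℕ (m ℕ.+ n)      ≈⟨ fromℕ≈×1# (m ℕ.+ n) ⟩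
    (m ℕ.+ n) ×′ 1#      ≈⟨ ×-homo-+ 1# m n ⟩
    m ×′ 1# + n ×′ 1#    ≈⟨ +-cong (fromℕ≈×1# m) (fromℕ≈×1# n) ⟨
    fromℕ m + fromℕ n    ∎

  fromℕ-* : ∀ m n → fromℕ (m ℕ.* n) ≈ fromℕ m * fromℕ n
  fromℕ-* m n = begin
    fromℕ (m ℕ.* n)      ≈⟨ fromℕ≈×1# (m ℕ.* n) ⟩
    (m ℕ.* n) ×′ 1#      ≈⟨ ×1-homo-* m n ⟩
    m ×′ 1# * n ×′ 1#    ≈⟨ *-cong (fromℕ≈×1# m) (fromℕ≈×1# n) ⟨
    fromℕ m * fromℕ n    ∎

  fromℤ : ℤ → Carrier
  fromℤ (ℤ.+ n) = fromℕ n
  fromℤ -[1+ n ] = - fromℕ (suc n)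

  fromSign : Sign → Carrier
  fromSign Sign.+ = 1#
  fromSign Sign.- = - 1#

  +-cancel-- : ∀ u a b → (u + a) + - (u + b) ≈ a + - b
  +-cancel-- u a b = begin
    (u + a) + - (u + b)   ≈⟨ +-congˡ (sym (⁻¹-∙-comm u b)) ⟩
    (u + a) + (- u + - b) ≈⟨ +-interchange u a (- u) (- b) ⟩
    (u + - u) + (a + - b) ≈⟨ +-congʳ (-‿inverseʳ u) ⟩
    0# + (a + - b)        ≈⟨ +-identityˡ _ ⟩
    a + - b               ∎

  fromℤ-⊖ : ∀ m n → fromℤ (m ℤ.⊖ n) ≈ fromℕ m + - fromℕ n
  fromℤ-⊖ zero zero = sym (-‿inverseʳ 0#)
  fromℤ-⊖ (suc m) zero = sym (trans (+-congˡ ε⁻¹≈ε) (+-identityʳ _))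
  fromℤ-⊖ zero (suc n) = sym (+-identityˡ _)
  fromℤ-⊖ (suc m) (suc n) = begin
    fromℤ (suc m ℤ.⊖ suc n)          ≡⟨ ≡.cong fromℤ (ℤ.[1+m]⊖[1+n]≡m⊖n m n) ⟩
    fromℤ (m ℤ.⊖ n)                  ≈⟨ fromℤ-⊖ m n ⟩
    fromℕ m + - fromℕ n              ≈⟨ +-cancel-- 1# _ _ ⟨
    (1# + fromℕ m) + - (1# + fromℕ n) ≈⟨ +-cong (fromℕ-+ 1 m) (-‿cong (fromℕ-+ 1 n)) ⟨
    fromℕ (suc m) + - fromℕ (suc n)  ∎

  fromℤ-+ : ∀ i j → fromℤ (i ℤ.+ j) ≈ fromℤ i + fromℤ j
  fromℤ-+ (ℤ.+ m) (ℤ.+ n) = fromℕ-+ m n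
  fromℤ-+ (ℤ.+ m) -[1+ n ] = fromℤ-⊖ m (suc n)
  fromℤ-+ -[1+ m ] (ℤ.+ n) = trans (fromℤ-⊖ n (suc m)) (+-comm _ _)
  fromℤ-+ -[1+ m ] -[1+ n ] = begin
    - fromℕ (suc (suc (m ℕ.+ n)))        ≡⟨ ≡.cong (λ k → - fromℕ (suc k)) (ℕ.+-suc m n) ⟨
    - fromℕ (suc m ℕ.+ suc n)            ≈⟨ -‿cong (fromℕ-+ (suc m) (suc n)) ⟩
    - (fromℕ (suc m) + fromℕ (suc n))    ≈⟨ ⁻¹-∙-comm _ _ ⟨
    - fromℕ (suc m) + - fromℕ (suc n)    ∎

  fromSign-* : ∀ s t → fromSign (s Sign.* t) ≈ fromSign s * fromSign t
  fromSign-* Sign.+ t = sym (*-identityˡ _)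
  fromSign-* Sign.- Sign.+ = sym (*-identityʳ _)
  fromSign-* Sign.- Sign.- = sym (trans (-1*x≈-x (- 1#)) (⁻¹-involutive 1#))

  fromℤ-◃ : ∀ s n → fromℤ (s ℤ.◃ n) ≈ fromSign s * fromℕ n
  fromℤ-◃ s zero = sym (zeroʳ _)
  fromℤ-◃ Sign.+ (suc n) = sym (*-identityˡ _)
  fromℤ-◃ Sign.- (suc n) = sym (-1*x≈-x _)

  fromℤ-sign-abs : ∀ i → fromℤ i ≈ fromSign (ℤ.sign i) * fromℕ ℤ.∣ i ∣
  fromℤ-sign-abs (ℤ.+ n) = sym (*-identityˡ _)
  fromℤ-sign-abs -[1+ n ] = sym (-1*x≈-x _)

  fromℤ-* : ∀ i j → fromℤ (i ℤ.* j) ≈ fromℤ i * fromℤ j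
  fromℤ-* i j = begin
    fromℤ (s ℤ.◃ ℤ.∣ i ∣ ℕ.* ℤ.∣ j ∣)                      ≈⟨ fromℤ-◃ s (ℤ.∣ i ∣ ℕ.* ℤ.∣ j ∣) ⟩
    fromSign s * fromℕ (ℤ.∣ i ∣ ℕ.* ℤ.∣ j ∣)                ≈⟨ *-cong (fromSign-* sᵢ sⱼ) (fromℕ-* ℤ.∣ i ∣ ℤ.∣ j ∣) ⟩
    (σᵢ * σⱼ) * (fromℕ ℤ.∣ i ∣ * fromℕ ℤ.∣ j ∣)              ≈⟨ *-interchange _ _ _ _ ⟩
    (σᵢ * fromℕ ℤ.∣ i ∣) * (σⱼ * fromℕ ℤ.∣ j ∣)              ≈⟨ *-cong (fromℤ-sign-abs i) (fromℤ-sign-abs j) ⟨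
    fromℤ i * fromℤ j                                      ∎
    where
    sᵢ sⱼ s : Sign
    sᵢ = ℤ.sign i
    sⱼ = ℤ.sign j
    s = sᵢ Sign.* sⱼ
    σᵢ σⱼ : Carrier
    σᵢ = fromSign sᵢ
    σⱼ = fromSign sⱼ

  fromℤ-neg : ∀ i → fromℤ (ℤ.- i) ≈ - fromℤ i
  fromℤ-neg (ℤ.+ zero) = sym ε⁻¹≈ε
  fromℤ-neg (ℤ.+ suc n) = refl
  fromℤ-neg -[1+ n ] = sym (⁻¹-involutive _)

  fromℤ-homomorphism : ℤ.+-*-rawRing -Raw-AlmostCommutative⟶ fromCommutativeRing R
  fromℤ-homomorphism = record
    { ⟦_⟧ = fromℤ ; +-homo = fromℤ-+ ; *-homo = fromℤ-* ; -‿homo = fromℤ-neg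
    ; 0-homo = refl ; 1-homo = refl }

  fromℤ-≟ : ∀ i j → Maybe (fromℤ i ≈ fromℤ j)
  fromℤ-≟ i j with i ℤ.≟ j
  ... | yes i≡j = just (reflexive (≡.cong fromℤ i≡j))
  ... | no _ = nothing

  open import Algebra.Solver.Ring ℤ.+-*-rawRing (fromCommutativeRing R) fromℤ-homomorphism fromℤ-≟ public
    using (Polynomial; solve; _:=_; con; _:+_; _:*_; :-_)

open ≡

length-≤-injection : ∀ {A B : Set} → DecidableEquality B → (xs : List A) (ys : List B) → Unique xs →
  (f : ∀ x → x ∈ xs → B) → (∀ x x∈ → f x x∈ ∈ ys) → (∀ x y x∈ y∈ → f x x∈ ≡ f y y∈ → x ≡ y) →
  length xs ≤ length ys
length-≤-injection _≟_ [] ys _ f f∈ f-inj = z≤n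
length-≤-injection {B = B} _≟_ (x ∷ xs) ys (x∉xs ∷ xs!) f f∈ f-inj =
  ℕ.≤-trans (s≤s rest) (filter-notAll (λ y → ¬? (y ≟ fx)) ys (Any.map (λ fx≡y y≢fx → y≢fx (sym fx≡y)) (f∈ x (here refl))))
  where
  fx : B
  fx = f x (here refl)
  rest : length xs ≤ length (filter (λ y → ¬? (y ≟ fx)) ys)
  rest = length-≤-injection _≟_ xs _ xs! (λ z z∈ → f z (there z∈))
    (λ z z∈ → ∈-filter⁺ (λ y → ¬? (y ≟ fx)) (f∈ z (there z∈))
                (λ fz≡fx → All.lookup x∉xs z∈ (sym (f-inj z x (there z∈) (here refl) fz≡fx))))
    (λ a b a∈ b∈ → f-inj a b (there a∈) (there b∈))

length-filter-≢ : ∀ {A : Set} (_≟_ : DecidableEquality A) (xs : List A) → Unique xs → ∀ {x} → x ∈ xs →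
  suc (length (filter (λ y → ¬? (y ≟ x)) xs)) ≡ length xs
length-filter-≢ _≟_ (y ∷ xs) (y∉xs ∷ _) (here refl) with y ≟ y
... | no y≢y = ⊥-elim (y≢y refl)
... | yes _ = cong suc (keep-all xs y∉xs)
  where
  keep-all : ∀ zs → All.All (y ≢_) zs → length (filter (λ z → ¬? (z ≟ y)) zs) ≡ length zs
  keep-all [] _ = refl
  keep-all (z ∷ zs) (y≢z ∷ y∉zs) with z ≟ y
  ... | yes z≡y = ⊥-elim (y≢z (sym z≡y))
  ... | no _ = cong suc (keep-all zs y∉zs)
length-filter-≢ _≟_ (y ∷ xs) (y∉xs ∷ xs!) {x} (there x∈xs) with y ≟ x
... | yes refl = ⊥-elim (All.lookup y∉xs x∈xs refl)
... | no _ = cong suc (length-filter-≢ _≟_ xs xs! x∈xs)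

length≡2⇒distinct-pair : ∀ {A : Set} (xs : List A) → length xs ≡ 2 → Unique xs →
  Σ A λ x → Σ A λ y → x ∈ xs × y ∈ xs × x ≢ y
length≡2⇒distinct-pair (x ∷ y ∷ []) refl ((x≢y ∷ []) ∷ _) = x , y , here refl , there (here refl) , x≢y

pair-unique : ∀ {A : Set} {a b : A} → a ≢ b → Unique (a ∷ b ∷ [])
pair-unique a≢b = (a≢b ∷ []) ∷ ([] ∷ [])

lookup-injective : ∀ {A : Set} (xs : List A) → Unique xs → ∀ i j → lookup xs i ≡ lookup xs j → i ≡ j
lookup-injective (x ∷ xs) _ Fin.zero Fin.zero _ = refl
lookup-injective (x ∷ xs) (x∉xs ∷ _) Fin.zero (Fin.suc j) x≡ = ⊥-elim (All.lookup x∉xs (∈-lookup j) x≡)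
lookup-injective (x ∷ xs) (x∉xs ∷ _) (Fin.suc i) Fin.zero ≡x = ⊥-elim (All.lookup x∉xs (∈-lookup i) (sym ≡x))
lookup-injective (x ∷ xs) (_ ∷ xs!) (Fin.suc i) (Fin.suc j) eq = cong Fin.suc (lookup-injective xs xs! i j eq)

length-cartesianProduct : ∀ {A B : Set} (xs : List A) (ys : List B) →
  length (cartesianProduct xs ys) ≡ length xs ℕ.* length ys
length-cartesianProduct [] ys = refl
length-cartesianProduct (x ∷ xs) ys =
  trans (length-++ (map (x ,_) ys)) (cong₂ ℕ._+_ (length-map (x ,_) ys) (length-cartesianProduct xs ys))

module FixedPointFreeOrder3 {A : Set} (_≟_ : DecidableEquality A) (σ : A → A) (σ³≡id : ∀ x → σ (σ (σ x)) ≡ x) where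

  σ-injective : ∀ {x y} → σ x ≡ σ y → x ≡ y
  σ-injective {x} {y} σx≡σy = trans (sym (σ³≡id x)) (trans (cong (λ z → σ (σ z)) σx≡σy) (σ³≡id y))

  without : A → List A → List A
  without a = filter (λ y → ¬? (y ≟ a))

  ∈-without⁺ : ∀ {a z xs} → z ∈ xs → z ≢ a → z ∈ without a xs
  ∈-without⁺ z∈ z≢a = ∈-filter⁺ (λ y → ¬? (y ≟ _)) z∈ z≢a

  ∈-without⁻ : ∀ {a z} xs → z ∈ without a xs → z ∈ xs × z ≢ a
  ∈-without⁻ xs = ∈-filter⁻ (λ y → ¬? (y ≟ _)) {xs = xs}

  -- Removing the orbit {x, σ x, σ² x} of the head keeps the list σ-closed; the length argument is fuel.
  3∣length : ∀ n (xs : List A) → length xs ≤ n → Unique xs →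
    (∀ x → x ∈ xs → σ x ∈ xs) → (∀ x → x ∈ xs → σ x ≢ x) → 3 ∣ length xs
  3∣length _ [] _ _ _ _ = divides 0 refl
  3∣length (suc n) (x ∷ xs) (s≤s len≤) xs! closed free = subst (3 ∣_) orbit-removed (add3 (3∣length n ys ys≤n ys! ys-closed ys-free))
    where
    zs : List A
    zs = x ∷ xs
    x₁ x₂ : A
    x₁ = σ x
    x₂ = σ x₁
    x₁∈ : x₁ ∈ zs
    x₁∈ = closed x (here refl)
    x₁≢x : x₁ ≢ x
    x₁≢x = free x (here refl)
    x₂≢x₁ : x₂ ≢ x₁
    x₂≢x₁ = free x₁ x₁∈
    x₂≢x : x₂ ≢ x
    x₂≢x x₂≡x = x₁≢x (trans (sym (cong σ x₂≡x)) (σ³≡id x))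
    ys₁ ys₂ ys : List A
    ys₁ = without x zs
    ys₂ = without x₁ ys₁
    ys = without x₂ ys₂
    ys₁! : Unique ys₁
    ys₁! = Unique.filter⁺ (λ y → ¬? (y ≟ x)) xs!
    ys₂! : Unique ys₂
    ys₂! = Unique.filter⁺ (λ y → ¬? (y ≟ x₁)) ys₁!
    ys! : Unique ys
    ys! = Unique.filter⁺ (λ y → ¬? (y ≟ x₂)) ys₂!
    orbit-removed : length ys ℕ.+ 3 ≡ length zs
    orbit-removed = trans (ℕ.+-comm (length ys) 3)
      (trans (cong (λ k → suc (suc k)) (length-filter-≢ _≟_ ys₂ ys₂! (∈-without⁺ (∈-without⁺ (closed x₁ x₁∈) x₂≢x) x₂≢x₁)))
      (trans (cong suc (length-filter-≢ _≟_ ys₁ ys₁! (∈-without⁺ x₁∈ x₁≢x))) (length-filter-≢ _≟_ zs xs! (here refl))))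
    ∈ys⁻ : ∀ {z} → z ∈ ys → z ∈ zs × z ≢ x × z ≢ x₁ × z ≢ x₂
    ∈ys⁻ z∈ with ∈-without⁻ ys₂ z∈
    ... | z∈₂ , z≢x₂ with ∈-without⁻ ys₁ z∈₂
    ...   | z∈₁ , z≢x₁ with ∈-without⁻ zs z∈₁
    ...     | z∈zs , z≢x = z∈zs , z≢x , z≢x₁ , z≢x₂
    ys-closed : ∀ z → z ∈ ys → σ z ∈ ys
    ys-closed z z∈ with ∈ys⁻ z∈
    ... | z∈zs , z≢x , z≢x₁ , z≢x₂ =
      ∈-without⁺ (∈-without⁺ (∈-without⁺ (closed z z∈zs)
        (λ σz≡x → z≢x₂ (trans (sym (σ³≡id z)) (cong (λ w → σ (σ w)) σz≡x))))
        (λ σz≡x₁ → z≢x (σ-injective σz≡x₁)))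
        (λ σz≡x₂ → z≢x₁ (σ-injective σz≡x₂))
    ys-free : ∀ z → z ∈ ys → σ z ≢ z
    ys-free z z∈ = free z (proj₁ (∈ys⁻ z∈))
    ys≤n : length ys ≤ n
    ys≤n = ℕ.≤-trans (ℕ.m≤m+n (length ys) 2)
      (subst (_≤ n) (sym (ℕ.suc-injective (trans (sym (ℕ.+-suc (length ys) 2)) orbit-removed))) len≤)
    add3 : ∀ {m} → 3 ∣ m → 3 ∣ m ℕ.+ 3
    add3 {m} (divides k refl) = divides (suc k) (ℕ.+-comm (k ℕ.* 3) 3)

module FieldProperties (F : FiniteField) where
  open FiniteField F

  commutativeRing : CommutativeRing _ _
  commutativeRing = record { isCommutativeRing = isCommutativeRing }

  open CommutativeRing commutativeRing public
    using (+-assoc; +-comm; *-assoc; *-comm; +-identityˡ; +-identityʳ; *-identityˡ; *-identityʳ;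
           -‿inverseʳ; zeroˡ; zeroʳ; +-group)
  open import Algebra.Properties.Group +-group public using (ε⁻¹≈ε; ⁻¹-involutive)
  open IntegerCoefficients commutativeRing public using (Polynomial; solve; _:=_; con; _:+_; _:*_; :-_)

  :0 :1 :2 :3 : ∀ {n} → Polynomial n
  :0 = con (ℤ.+ 0)
  :1 = con (ℤ.+ 1)
  :2 = con (ℤ.+ 2)
  :3 = con (ℤ.+ 3)

  1≢0 : 1# ≢ 0#
  1≢0 1≡0 = 0≢1 (sym 1≡0)

  -0≡0 : - 0# ≡ 0#
  -0≡0 = ε⁻¹≈ε

  inv : (x : Carrier) → x ≢ 0# → Carrier
  inv x x≢0 = proj₁ (inverse x x≢0)

  *-inverseʳ : ∀ x x≢0 → x * inv x x≢0 ≡ 1#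
  *-inverseʳ x x≢0 = proj₂ (inverse x x≢0)

  *-inverseˡ : ∀ x x≢0 → inv x x≢0 * x ≡ 1#
  *-inverseˡ x x≢0 = trans (*-comm _ _) (*-inverseʳ x x≢0)

  *-cancelˡ : ∀ {a x y} → a ≢ 0# → a * x ≡ a * y → x ≡ y
  *-cancelˡ {a} {x} {y} a≢0 ax≡ay = begin
    x                    ≡⟨ *-identityˡ x ⟨
    1# * x               ≡⟨ cong (_* x) (*-inverseˡ a a≢0) ⟨
    inv a a≢0 * a * x    ≡⟨ *-assoc _ _ _ ⟩
    inv a a≢0 * (a * x)  ≡⟨ cong (inv a a≢0 *_) ax≡ay ⟩
    inv a a≢0 * (a * y)  ≡⟨ *-assoc _ _ _ ⟨
    inv a a≢0 * a * y    ≡⟨ cong (_* y) (*-inverseˡ a a≢0) ⟩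
    1# * y               ≡⟨ *-identityˡ y ⟩
    y                    ∎
    where open ≡-Reasoning

  *-nonzero : ∀ {a b} → a ≢ 0# → b ≢ 0# → a * b ≢ 0#
  *-nonzero {a} a≢0 b≢0 ab≡0 = b≢0 (*-cancelˡ a≢0 (trans ab≡0 (sym (zeroʳ a))))

  zero-product : ∀ {a b} → a * b ≡ 0# → a ≡ 0# ⊎ b ≡ 0#
  zero-product {a} {b} ab≡0 with a ≟ 0# | b ≟ 0#
  ... | yes a≡0 | _ = inj₁ a≡0
  ... | no _ | yes b≡0 = inj₂ b≡0
  ... | no a≢0 | no b≢0 = ⊥-elim (*-nonzero a≢0 b≢0 ab≡0)

  x²≡0⇒x≡0 : ∀ {x} → x * x ≡ 0# → x ≡ 0#
  x²≡0⇒x≡0 x²≡0 with zero-product x²≡0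
  ... | inj₁ x≡0 = x≡0
  ... | inj₂ x≡0 = x≡0

  x³≡0⇒x≡0 : ∀ {x} → x * x * x ≡ 0# → x ≡ 0#
  x³≡0⇒x≡0 x³≡0 with zero-product x³≡0
  ... | inj₁ x²≡0 = x²≡0⇒x≡0 x²≡0
  ... | inj₂ x≡0 = x≡0

  x²y≡0 : ∀ {x y} → x * x * y ≡ 0# → x ≡ 0# ⊎ y ≡ 0#
  x²y≡0 x²y≡0 with zero-product x²y≡0
  ... | inj₁ x²≡0 = inj₁ (x²≡0⇒x≡0 x²≡0)
  ... | inj₂ y≡0 = inj₂ y≡0

  x-y≡0⇒x≡y : ∀ {x y} → x + - y ≡ 0# → x ≡ y
  x-y≡0⇒x≡y {x} {y} x-y≡0 =
    trans (solve 2 (λ x y → x := (x :+ :- y) :+ y) refl x y) (trans (cong (_+ y) x-y≡0) (+-identityˡ y))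

  x≡y⇒x-y≡0 : ∀ {x y} → x ≡ y → x + - y ≡ 0#
  x≡y⇒x-y≡0 {x} refl = -‿inverseʳ x

  x≢y⇒x-y≢0 : ∀ {x y} → x ≢ y → x + - y ≢ 0#
  x≢y⇒x-y≢0 x≢y x-y≡0 = x≢y (x-y≡0⇒x≡y x-y≡0)

  0*x+y≡y : ∀ x y → 0# * x + y ≡ y
  0*x+y≡y x y = trans (cong (_+ y) (zeroˡ x)) (+-identityˡ y)

  x+0≡x : ∀ {x e} → e ≡ 0# → x + e ≡ x
  x+0≡x {x} refl = +-identityʳ x

  linear-zero : ∀ k m {a b} → a ≡ 0# → b ≡ 0# → k * a + m * b ≡ 0#
  linear-zero k m refl refl = trans (cong₂ _+_ (zeroʳ k) (zeroʳ m)) (+-identityˡ 0#)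

  y≡x*[y/x] : ∀ x y (x≢0 : x ≢ 0#) → y ≡ x * (y * inv x x≢0)
  y≡x*[y/x] x y x≢0 = sym (trans (solve 3 (λ x y i → x :* (y :* i) := y :* (x :* i)) refl x y (inv x x≢0))
                              (trans (cong (y *_) (*-inverseʳ x x≢0)) (*-identityʳ y)))

  root : ∀ l m → l ≢ 0# → Carrier
  root l m l≢0 = - (m * inv l l≢0)

  root-isRoot : ∀ l m l≢0 → l * root l m l≢0 + m ≡ 0#
  root-isRoot l m l≢0 = trans (solve 3 (λ l m i → l :* (:- (m :* i)) :+ m := m :+ :- (m :* (l :* i))) refl l m (inv l l≢0))
    (trans (cong (λ z → m + - (m * z)) (*-inverseʳ l l≢0)) (trans (cong (λ z → m + - z) (*-identityʳ m)) (-‿inverseʳ m)))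

  root-unique : ∀ {l m s u} → l ≢ 0# → l * s + m ≡ 0# → l * u + m ≡ 0# → s ≡ u
  root-unique {l} {m} {s} {u} l≢0 ls+m≡0 lu+m≡0 = *-cancelˡ l≢0 (begin
    l * s                ≡⟨ solve 3 (λ l m s → l :* s := (l :* s :+ m) :+ :- m) refl l m s ⟩
    (l * s + m) + - m    ≡⟨ cong (_+ - m) (trans ls+m≡0 (sym lu+m≡0)) ⟩
    (l * u + m) + - m    ≡⟨ solve 3 (λ l m u → (l :* u :+ m) :+ :- m := l :* u) refl l m u ⟩
    l * u                ∎)
    where open ≡-Reasoning

  root⇒coefficient : ∀ {l m u} → l * u + m ≡ 0# → m ≡ - (l * u)
  root⇒coefficient {l} {m} {u} lu+m≡0 = trans (solve 3 (λ l m u → m := (l :* u :+ m) :+ :- (l :* u)) refl l m u)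
    (trans (cong (_+ - (l * u)) lu+m≡0) (+-identityˡ _))

  NotBothZero : Carrier → Carrier → Set
  NotBothZero l m = ¬ (l ≡ 0# × m ≡ 0#)

  kernel⇒left-kernel : ∀ a₁ a₂ b₁ b₂ k m → k * a₁ + m * b₁ ≡ 0# → k * a₂ + m * b₂ ≡ 0# → NotBothZero k m →
    Σ Carrier λ l → Σ Carrier λ n → NotBothZero l n × l * a₁ + n * a₂ ≡ 0# × l * b₁ + n * b₂ ≡ 0#
  kernel⇒left-kernel a₁ a₂ b₁ b₂ k m e₁ e₂ k,m≢0 with (a₁ ≟ 0#) ×-dec (a₂ ≟ 0#)
  ... | no a≢0 = a₂ , - a₁ , a₂,-a₁≢0 , solve 2 (λ a₁ a₂ → a₂ :* a₁ :+ (:- a₁) :* a₂ := :0) refl a₁ a₂ , b-row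
    where
    a₂,-a₁≢0 : NotBothZero a₂ (- a₁)
    a₂,-a₁≢0 (a₂≡0 , -a₁≡0) = a≢0 (trans (sym (⁻¹-involutive a₁)) (trans (cong -_ -a₁≡0) -0≡0) , a₂≡0)
    b-row : a₂ * b₁ + (- a₁) * b₂ ≡ 0#
    b-row with m ≟ 0#
    ... | no m≢0 = *-cancelˡ m≢0 (trans
            (solve 6 (λ a₁ a₂ b₁ b₂ k m → m :* (a₂ :* b₁ :+ (:- a₁) :* b₂)
                                       := a₂ :* (k :* a₁ :+ m :* b₁) :+ :- (a₁ :* (k :* a₂ :+ m :* b₂)))
              refl a₁ a₂ b₁ b₂ k m)
            (trans (cong₂ (λ u v → a₂ * u + - (a₁ * v)) e₁ e₂) (solve 3 (λ a₁ a₂ m → a₂ :* :0 :+ :- (a₁ :* :0) := m :* :0) refl a₁ a₂ m)))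
    ... | yes refl = ⊥-elim (a≢0 (k*a≡0 e₁ , k*a≡0 e₂))
      where
      k≢0 : k ≢ 0#
      k≢0 k≡0 = k,m≢0 (k≡0 , refl)
      k*a≡0 : ∀ {a b} → k * a + 0# * b ≡ 0# → a ≡ 0#
      k*a≡0 {a} {b} e = *-cancelˡ k≢0 (trans (trans (sym (+-identityʳ (k * a))) (cong (λ z → k * a + z) (sym (zeroˡ b)))) (trans e (sym (zeroʳ k))))
  ... | yes (refl , refl) with (b₁ ≟ 0#) ×-dec (b₂ ≟ 0#)
  ...   | no b≢0 = b₂ , - b₁ , (λ (b₂≡0 , -b₁≡0) → b≢0 (trans (sym (⁻¹-involutive b₁)) (trans (cong -_ -b₁≡0) -0≡0) , b₂≡0)) ,
                   solve 2 (λ b₁ b₂ → b₂ :* :0 :+ (:- b₁) :* :0 := :0) refl b₁ b₂ ,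
                   solve 2 (λ b₁ b₂ → b₂ :* b₁ :+ (:- b₁) :* b₂ := :0) refl b₁ b₂
  ...   | yes (refl , refl) = 1# , 0# , (λ (1≡0 , _) → 1≢0 1≡0) , solve 0 (:1 :* :0 :+ :0 :* :0 := :0) refl , solve 0 (:1 :* :0 :+ :0 :* :0 := :0) refl

  det≢0⇒trivial-kernel : ∀ {l m l' m' a₁ a₂} → l * a₁ + m * a₂ ≡ 0# → l' * a₁ + m' * a₂ ≡ 0# → l * m' + - (l' * m) ≢ 0# →
    a₁ ≡ 0# × a₂ ≡ 0#
  det≢0⇒trivial-kernel {l} {m} {l'} {m'} {a₁} {a₂} e e' det≢0 =
    *-cancelˡ det≢0 (trans (solve 6 (λ l m l' m' a₁ a₂ → (l :* m' :+ :- (l' :* m)) :* a₁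
                                                      := m' :* (l :* a₁ :+ m :* a₂) :+ :- (m :* (l' :* a₁ :+ m' :* a₂)))
                               refl l m l' m' a₁ a₂)
                         (trans (cong₂ (λ u v → m' * u + - (m * v)) e e') (solve 3 (λ m m' d → m' :* :0 :+ :- (m :* :0) := d :* :0) refl m m' _))) ,
    *-cancelˡ det≢0 (trans (solve 6 (λ l m l' m' a₁ a₂ → (l :* m' :+ :- (l' :* m)) :* a₂
                                                      := l :* (l' :* a₁ :+ m' :* a₂) :+ :- (l' :* (l :* a₁ :+ m :* a₂)))
                               refl l m l' m' a₁ a₂)
                         (trans (cong₂ (λ u v → l * u + - (l' * v)) e' e) (solve 3 (λ l l' d → l :* :0 :+ :- (l' :* :0) := d :* :0) refl l l' _)))

  det≡0⇒proportional : ∀ {l m l' m'} → NotBothZero l m → NotBothZero l' m' → l * m' + - (l' * m) ≡ 0# →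
    Σ Carrier λ κ → κ ≢ 0# × l' ≡ κ * l × m' ≡ κ * m
  det≡0⇒proportional {l} {m} {l'} {m'} l,m≢0 l',m'≢0 det≡0 with l ≟ 0#
  ... | no l≢0 = κ , κ≢0 , l'≡κl , m'≡κm
    where
    κ : Carrier
    κ = l' * inv l l≢0
    l'≡κl : l' ≡ κ * l
    l'≡κl = sym (trans (solve 3 (λ l' i l → l' :* i :* l := l' :* (l :* i)) refl l' _ l) (trans (cong (l' *_) (*-inverseʳ l l≢0)) (*-identityʳ l')))
    m'≡κm : m' ≡ κ * m
    m'≡κm = *-cancelˡ l≢0 (trans (x-y≡0⇒x≡y det≡0)
      (sym (trans (solve 4 (λ l l' i m → l :* (l' :* i :* m) := (l :* i) :* (l' :* m)) refl l l' _ m)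
                  (trans (cong (_* (l' * m)) (*-inverseʳ l l≢0)) (*-identityˡ _)))))
    κ≢0 : κ ≢ 0#
    κ≢0 κ≡0 = l',m'≢0 (trans l'≡κl (trans (cong (_* l) κ≡0) (zeroˡ l)) , trans m'≡κm (trans (cong (_* m) κ≡0) (zeroˡ m)))
  ... | yes refl = κ , κ≢0 , trans l'≡0 (sym (zeroʳ κ)) , m'≡κm
    where
    m≢0 : m ≢ 0#
    m≢0 m≡0 = l,m≢0 (refl , m≡0)
    κ : Carrier
    κ = m' * inv m m≢0
    l'≡0 : l' ≡ 0#
    l'≡0 with zero-product (trans (sym (⁻¹-involutive _)) (trans (cong -_ (trans (sym (0*x+y≡y m' (- (l' * m)))) det≡0)) -0≡0))
    ... | inj₁ l'≡0 = l'≡0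
    ... | inj₂ m≡0 = ⊥-elim (m≢0 m≡0)
    m'≡κm : m' ≡ κ * m
    m'≡κm = sym (trans (solve 3 (λ m' i m → m' :* i :* m := m' :* (m :* i)) refl m' _ m) (trans (cong (m' *_) (*-inverseʳ m m≢0)) (*-identityʳ m')))
    κ≢0 : κ ≢ 0#
    κ≢0 κ≡0 = l',m'≢0 (l'≡0 , trans m'≡κm (trans (cong (_* m) κ≡0) (zeroˡ m)))

module ProjectiveSpace (F : FiniteField) where
  open FiniteField F
  open Geom F
  open FieldProperties F

  π₀ π₁ π₂ π₃ : V → Carrier
  π₀ = proj₁
  π₁ v = proj₁ (proj₂ v)
  π₂ v = proj₁ (proj₂ (proj₂ v))
  π₃ v = proj₂ (proj₂ (proj₂ v))

  ≡⁴ : ∀ {a b c d a' b' c' d'} → a ≡ a' → b ≡ b' → c ≡ c' → d ≡ d' →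
       _≡_ {A = V} (a , b , c , d) (a' , b' , c' , d')
  ≡⁴ refl refl refl refl = refl

  ⊙-identity : ∀ X → 1# ⊙ X ≡ X
  ⊙-identity (a , b , c , d) = ≡⁴ (*-identityˡ a) (*-identityˡ b) (*-identityˡ c) (*-identityˡ d)

  ⊙-assoc : ∀ k m X → k ⊙ (m ⊙ X) ≡ (k * m) ⊙ X
  ⊙-assoc k m (a , b , c , d) = ≡⁴ (sym (*-assoc k m a)) (sym (*-assoc k m b)) (sym (*-assoc k m c)) (sym (*-assoc k m d))

  ⊙-zeroˡ : ∀ X → 0# ⊙ X ≡ 𝟎v
  ⊙-zeroˡ (a , b , c , d) = ≡⁴ (zeroˡ a) (zeroˡ b) (zeroˡ c) (zeroˡ d)

  ⊙-zeroʳ : ∀ k → k ⊙ 𝟎v ≡ 𝟎v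
  ⊙-zeroʳ k = ≡⁴ (zeroʳ k) (zeroʳ k) (zeroʳ k) (zeroʳ k)

  ⊙-cancel : ∀ {k X Y} → k ≢ 0# → k ⊙ X ≡ k ⊙ Y → X ≡ Y
  ⊙-cancel {k} {X} {Y} k≢0 kX≡kY = begin
    X                          ≡⟨ ⊙-identity X ⟨
    1# ⊙ X                     ≡⟨ cong (_⊙ X) (*-inverseˡ k k≢0) ⟨
    (inv k k≢0 * k) ⊙ X      ≡⟨ ⊙-assoc _ _ X ⟨
    inv k k≢0 ⊙ (k ⊙ X)      ≡⟨ cong (inv k k≢0 ⊙_) kX≡kY ⟩
    inv k k≢0 ⊙ (k ⊙ Y)      ≡⟨ ⊙-assoc _ _ Y ⟩
    (inv k k≢0 * k) ⊙ Y      ≡⟨ cong (_⊙ Y) (*-inverseˡ k k≢0) ⟩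
    1# ⊙ Y                     ≡⟨ ⊙-identity Y ⟩
    Y                          ∎
    where open ≡-Reasoning

  ⊙-nonzero : ∀ {k X} → k ≢ 0# → X ≢ 𝟎v → k ⊙ X ≢ 𝟎v
  ⊙-nonzero {k} k≢0 X≢0 kX≡0 = X≢0 (⊙-cancel k≢0 (trans kX≡0 (sym (⊙-zeroʳ k))))

  combination-scale : ∀ k l m A B → ((k * l) ⊙ A) ⊕ ((k * m) ⊙ B) ≡ k ⊙ ((l ⊙ A) ⊕ (m ⊙ B))
  combination-scale k l m (a₀ , a₁ , a₂ , a₃) (b₀ , b₁ , b₂ , b₃) = ≡⁴ (coord a₀ b₀) (coord a₁ b₁) (coord a₂ b₂) (coord a₃ b₃)
    where
    coord : ∀ a b → (k * l) * a + (k * m) * b ≡ k * (l * a + m * b)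
    coord a b = solve 5 (λ k l m a b → (k :* l) :* a :+ (k :* m) :* b := k :* (l :* a :+ m :* b)) refl k l m a b

  combination-zeroʳ : ∀ a P D → (a ⊙ P) ⊕ (0# ⊙ D) ≡ a ⊙ P
  combination-zeroʳ a (p₀ , p₁ , p₂ , p₃) (d₀ , d₁ , d₂ , d₃) = ≡⁴ (coord _ _) (coord _ _) (coord _ _) (coord _ _)
    where
    coord : ∀ x y → a * x + 0# * y ≡ a * x
    coord x y = solve 3 (λ a x y → a :* x :+ :0 :* y := a :* x) refl a x y

  combination-zero : ∀ A B → (0# ⊙ A) ⊕ (0# ⊙ B) ≡ 𝟎v
  combination-zero A B = trans (cong₂ _⊕_ (⊙-zeroˡ A) (⊙-zeroˡ B)) (≡⁴ (+-identityʳ 0#) (+-identityʳ 0#) (+-identityʳ 0#) (+-identityʳ 0#))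

  combination-eliminate : ∀ a b a' b' P D →
    (b' ⊙ ((a ⊙ P) ⊕ (b ⊙ D))) ⊕ ((- b) ⊙ ((a' ⊙ P) ⊕ (b' ⊙ D))) ≡ (a * b' + - (a' * b)) ⊙ P
  combination-eliminate a b a' b' (p₀ , p₁ , p₂ , p₃) (d₀ , d₁ , d₂ , d₃) = ≡⁴ (coord p₀ d₀) (coord p₁ d₁) (coord p₂ d₂) (coord p₃ d₃)
    where
    coord : ∀ x y → b' * (a * x + b * y) + (- b) * (a' * x + b' * y) ≡ (a * b' + - (a' * b)) * x
    coord x y = solve 6 (λ a b a' b' x y → b' :* (a :* x :+ b :* y) :+ (:- b) :* (a' :* x :+ b' :* y) := (a :* b' :+ :- (a' :* b)) :* x)
      refl a b a' b' x y

  combination-det≡0 : ∀ a b a' b' P D → a * b' + - (a' * b) ≡ 0# →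
    b' ⊙ ((a ⊙ P) ⊕ (b ⊙ D)) ≡ b ⊙ ((a' ⊙ P) ⊕ (b' ⊙ D))
  combination-det≡0 a b a' b' (p₀ , p₁ , p₂ , p₃) (d₀ , d₁ , d₂ , d₃) det≡0 =
    ≡⁴ (coord p₀ d₀) (coord p₁ d₁) (coord p₂ d₂) (coord p₃ d₃)
    where
    coord : ∀ x y → b' * (a * x + b * y) ≡ b * (a' * x + b' * y)
    coord x y = trans (solve 6 (λ a b a' b' x y → b' :* (a :* x :+ b :* y) := b :* (a' :* x :+ b' :* y) :+ (a :* b' :+ :- (a' :* b)) :* x)
                         refl a b a' b' x y)
                      (x+0≡x (trans (cong (_* x) det≡0) (zeroˡ x)))

  Proj-refl : ∀ X → Proj X X
  Proj-refl X = 1# , 1≢0 , sym (⊙-identity X)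

  Proj-sym : ∀ {X Y} → Proj X Y → Proj Y X
  Proj-sym {X} {Y} (k , k≢0 , refl) = inv k k≢0 , k⁻¹≢0 ,
    sym (trans (⊙-assoc _ _ Y) (trans (cong (_⊙ Y) (*-inverseˡ k k≢0)) (⊙-identity Y)))
    where
    k⁻¹≢0 : inv k k≢0 ≢ 0#
    k⁻¹≢0 k⁻¹≡0 = 1≢0 (trans (sym (*-inverseʳ k k≢0)) (trans (cong (k *_) k⁻¹≡0) (zeroʳ k)))

  Proj-trans : ∀ {X Y Z} → Proj X Y → Proj Y Z → Proj X Z
  Proj-trans (k , k≢0 , refl) (m , m≢0 , refl) = k * m , *-nonzero k≢0 m≢0 , ⊙-assoc k m _

  Proj-nonzero : ∀ {X Y} → Proj X Y → Y ≢ 𝟎v → X ≢ 𝟎v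
  Proj-nonzero (k , k≢0 , refl) = ⊙-nonzero k≢0

  Proj-⊙ : ∀ {k m X Y} → k ≢ 0# → m ≢ 0# → k ⊙ X ≡ m ⊙ Y → Proj X Y
  Proj-⊙ {k} {m} {X} {Y} k≢0 m≢0 kX≡mY = Proj-trans (Proj-sym (k , k≢0 , refl)) (subst (λ Z → Proj Z Y) (sym kX≡mY) (m , m≢0 , refl))

  dot-⊙ʳ : ∀ c k X → dot c (k ⊙ X) ≡ k * dot c X
  dot-⊙ʳ (c₀ , c₁ , c₂ , c₃) k (x₀ , x₁ , x₂ , x₃) =
    solve 9 (λ c₀ c₁ c₂ c₃ k x₀ x₁ x₂ x₃ →
      c₀ :* (k :* x₀) :+ c₁ :* (k :* x₁) :+ c₂ :* (k :* x₂) :+ c₃ :* (k :* x₃) :=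
      k :* (c₀ :* x₀ :+ c₁ :* x₁ :+ c₂ :* x₂ :+ c₃ :* x₃)) refl c₀ c₁ c₂ c₃ k x₀ x₁ x₂ x₃

  dot-⊙ˡ : ∀ c k X → dot (k ⊙ c) X ≡ k * dot c X
  dot-⊙ˡ (c₀ , c₁ , c₂ , c₃) k (x₀ , x₁ , x₂ , x₃) =
    solve 9 (λ c₀ c₁ c₂ c₃ k x₀ x₁ x₂ x₃ →
      (k :* c₀) :* x₀ :+ (k :* c₁) :* x₁ :+ (k :* c₂) :* x₂ :+ (k :* c₃) :* x₃ :=
      k :* (c₀ :* x₀ :+ c₁ :* x₁ :+ c₂ :* x₂ :+ c₃ :* x₃)) refl c₀ c₁ c₂ c₃ k x₀ x₁ x₂ x₃

  dot-combinationʳ : ∀ c k A m B → dot c ((k ⊙ A) ⊕ (m ⊙ B)) ≡ k * dot c A + m * dot c B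
  dot-combinationʳ (c₀ , c₁ , c₂ , c₃) k (a₀ , a₁ , a₂ , a₃) m (b₀ , b₁ , b₂ , b₃) =
    solve 14 (λ c₀ c₁ c₂ c₃ k a₀ a₁ a₂ a₃ m b₀ b₁ b₂ b₃ →
      c₀ :* (k :* a₀ :+ m :* b₀) :+ c₁ :* (k :* a₁ :+ m :* b₁) :+ c₂ :* (k :* a₂ :+ m :* b₂) :+ c₃ :* (k :* a₃ :+ m :* b₃) :=
      k :* (c₀ :* a₀ :+ c₁ :* a₁ :+ c₂ :* a₂ :+ c₃ :* a₃) :+ m :* (c₀ :* b₀ :+ c₁ :* b₁ :+ c₂ :* b₂ :+ c₃ :* b₃))
      refl c₀ c₁ c₂ c₃ k a₀ a₁ a₂ a₃ m b₀ b₁ b₂ b₃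

  dot-combinationˡ : ∀ k c m d X → dot ((k ⊙ c) ⊕ (m ⊙ d)) X ≡ k * dot c X + m * dot d X
  dot-combinationˡ k (c₀ , c₁ , c₂ , c₃) m (d₀ , d₁ , d₂ , d₃) (x₀ , x₁ , x₂ , x₃) =
    solve 14 (λ k c₀ c₁ c₂ c₃ m d₀ d₁ d₂ d₃ x₀ x₁ x₂ x₃ →
      (k :* c₀ :+ m :* d₀) :* x₀ :+ (k :* c₁ :+ m :* d₁) :* x₁ :+ (k :* c₂ :+ m :* d₂) :* x₂ :+ (k :* c₃ :+ m :* d₃) :* x₃ :=
      k :* (c₀ :* x₀ :+ c₁ :* x₁ :+ c₂ :* x₂ :+ c₃ :* x₃) :+ m :* (d₀ :* x₀ :+ d₁ :* x₁ :+ d₂ :* x₂ :+ d₃ :* x₃))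
      refl k c₀ c₁ c₂ c₃ m d₀ d₁ d₂ d₃ x₀ x₁ x₂ x₃

  OnPlane-respˡ : ∀ {X Y c} → Proj X Y → OnPlane Y c → OnPlane X c
  OnPlane-respˡ {c = c} (k , _ , refl) Y∈c = trans (dot-⊙ʳ c k _) (trans (cong (k *_) Y∈c) (zeroʳ k))

  OnPlane-respʳ : ∀ {X c d} → Proj c d → OnPlane X d → OnPlane X c
  OnPlane-respʳ {X} (k , _ , refl) X∈d = trans (dot-⊙ˡ _ k X) (trans (cong (k *_) X∈d) (zeroʳ k))

  LineInPlane-resp : ∀ {A B c d} → Proj c d → LineInPlane A B d → LineInPlane A B c
  LineInPlane-resp c~d (A∈d , B∈d) = OnPlane-respʳ c~d A∈d , OnPlane-respʳ c~d B∈d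

  OnLine⇒OnPlane : ∀ {X A B c} → OnLine X A B → LineInPlane A B c → OnPlane X c
  OnLine⇒OnPlane {A = A} {B} {c} (k , m , refl) (A∈c , B∈c) = trans (dot-combinationʳ c k A m B) (linear-zero k m A∈c B∈c)

  OnLine-combination : ∀ {X Y A B} k m → OnLine X A B → OnLine Y A B → OnLine ((k ⊙ X) ⊕ (m ⊙ Y)) A B
  OnLine-combination {A = a₀ , a₁ , a₂ , a₃} {B = b₀ , b₁ , b₂ , b₃} k m (x , y , refl) (x' , y' , refl) =
    k * x + m * x' , k * y + m * y' , ≡⁴ (coord a₀ b₀) (coord a₁ b₁) (coord a₂ b₂) (coord a₃ b₃)
    where
    coord : ∀ a b → k * (x * a + y * b) + m * (x' * a + y' * b) ≡ (k * x + m * x') * a + (k * y + m * y') * b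
    coord a b = solve 8 (λ k m x y x' y' a b →
      k :* (x :* a :+ y :* b) :+ m :* (x' :* a :+ y' :* b) := (k :* x :+ m :* x') :* a :+ (k :* y :+ m :* y') :* b)
      refl k m x y x' y' a b

  OnLine-resp : ∀ {X Y A B} → Proj X Y → OnLine Y A B → OnLine X A B
  OnLine-resp {A = a₀ , a₁ , a₂ , a₃} {B = b₀ , b₁ , b₂ , b₃} (k , _ , refl) (x , y , refl) =
    k * x , k * y , ≡⁴ (coord a₀ b₀) (coord a₁ b₁) (coord a₂ b₂) (coord a₃ b₃)
    where
    coord : ∀ a b → k * (x * a + y * b) ≡ (k * x) * a + (k * y) * b
    coord a b = solve 5 (λ k x y a b → k :* (x :* a :+ y :* b) := (k :* x) :* a :+ (k :* y) :* b) refl k x y a b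

  OnLine-first : ∀ A B → OnLine A A B
  OnLine-first (a₀ , a₁ , a₂ , a₃) (b₀ , b₁ , b₂ , b₃) = 1# , 0# , ≡⁴ (coord a₀ b₀) (coord a₁ b₁) (coord a₂ b₂) (coord a₃ b₃)
    where
    coord : ∀ a b → a ≡ 1# * a + 0# * b
    coord a b = solve 2 (λ a b → a := :1 :* a :+ :0 :* b) refl a b

  OnLine-second : ∀ A B → OnLine B A B
  OnLine-second (a₀ , a₁ , a₂ , a₃) (b₀ , b₁ , b₂ , b₃) = 0# , 1# , ≡⁴ (coord a₀ b₀) (coord a₁ b₁) (coord a₂ b₂) (coord a₃ b₃)
    where
    coord : ∀ a b → b ≡ 0# * a + 1# * b
    coord a b = solve 2 (λ a b → b := :0 :* a :+ :1 :* b) refl a b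

  ∈points : ∀ {X} → Normalized X → X ∈ points
  ∈points {a , b , c , d} =
    ∈-filter⁺ Normalized? (∈-cartesianProduct⁺ (complete a) (∈-cartesianProduct⁺ (complete b) (∈-cartesianProduct⁺ (complete c) (complete d))))

  ∈points⇒Normalized : ∀ {X} → X ∈ points → Normalized X
  ∈points⇒Normalized X∈ = proj₂ (∈-filter⁻ Normalized? {xs = allVecs} X∈)

  points-unique : Unique points
  points-unique = Unique.filter⁺ Normalized? {xs = allVecs}
    (Unique.cartesianProduct⁺ unique (Unique.cartesianProduct⁺ unique (Unique.cartesianProduct⁺ unique unique)))

  Normalized⇒nonzero : ∀ {X} → Normalized X → X ≢ 𝟎v
  Normalized⇒nonzero (inj₁ 0≡1) refl = 0≢1 0≡1
  Normalized⇒nonzero (inj₂ (inj₁ (_ , 0≡1))) refl = 0≢1 0≡1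
  Normalized⇒nonzero (inj₂ (inj₂ (inj₁ (_ , _ , 0≡1)))) refl = 0≢1 0≡1
  Normalized⇒nonzero (inj₂ (inj₂ (inj₂ (_ , _ , _ , 0≡1)))) refl = 0≢1 0≡1

  ∈points⇒nonzero : ∀ {X} → X ∈ points → X ≢ 𝟎v
  ∈points⇒nonzero X∈ = Normalized⇒nonzero (∈points⇒Normalized X∈)

  Proj-inv⊙ : ∀ k k≢0 X → Proj X (inv k k≢0 ⊙ X)
  Proj-inv⊙ k k≢0 X = k , k≢0 , sym (trans (⊙-assoc _ _ X) (trans (cong (_⊙ X) (*-inverseʳ k k≢0)) (⊙-identity X)))

  normalize : (X : V) → X ≢ 𝟎v → Σ V λ Y → Normalized Y × Proj X Y
  normalize X@(a , b , c , d) X≢0 with a ≟ 0#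
  ... | no a≢0 = inv a a≢0 ⊙ X , inj₁ (*-inverseˡ a a≢0) , Proj-inv⊙ a a≢0 X
  ... | yes refl with b ≟ 0#
  ...   | no b≢0 = inv b b≢0 ⊙ X , inj₂ (inj₁ (zeroʳ _ , *-inverseˡ b b≢0)) , Proj-inv⊙ b b≢0 X
  ...   | yes refl with c ≟ 0#
  ...     | no c≢0 = inv c c≢0 ⊙ X , inj₂ (inj₂ (inj₁ (zeroʳ _ , zeroʳ _ , *-inverseˡ c c≢0))) , Proj-inv⊙ c c≢0 X
  ...     | yes refl with d ≟ 0#
  ...       | no d≢0 = inv d d≢0 ⊙ X , inj₂ (inj₂ (inj₂ (zeroʳ _ , zeroʳ _ , zeroʳ _ , *-inverseˡ d d≢0))) , Proj-inv⊙ d d≢0 X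
  ...       | yes refl = ⊥-elim (X≢0 refl)

  Normalized-Proj⇒≡ : ∀ {X Y} → Normalized X → Normalized Y → Proj X Y → X ≡ Y
  Normalized-Proj⇒≡ {X} {Y} NX NY (k , k≢0 , X≡kY) = trans X≡kY (trans (cong (_⊙ Y) (scale≡1 NX NY X≡kY)) (⊙-identity Y))
    where
    same : 1# ≡ k * 1# → k ≡ 1#
    same 1≡k = trans (sym (*-identityʳ k)) (sym 1≡k)
    later : 0# ≡ k * 1# → ⊥
    later 0≡k = k≢0 (trans (sym (*-identityʳ k)) (sym 0≡k))
    earlier : 1# ≡ k * 0# → ⊥
    earlier 1≡0 = 1≢0 (trans 1≡0 (zeroʳ k))
    scale≡1 : ∀ {X Y} → Normalized X → Normalized Y → X ≡ k ⊙ Y → k ≡ 1#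
    scale≡1 (inj₁ refl) (inj₁ refl) eq = same (cong π₀ eq)
    scale≡1 (inj₂ (inj₁ (refl , _))) (inj₁ refl) eq = ⊥-elim (later (cong π₀ eq))
    scale≡1 (inj₂ (inj₂ (inj₁ (refl , _)))) (inj₁ refl) eq = ⊥-elim (later (cong π₀ eq))
    scale≡1 (inj₂ (inj₂ (inj₂ (refl , _)))) (inj₁ refl) eq = ⊥-elim (later (cong π₀ eq))
    scale≡1 (inj₁ refl) (inj₂ (inj₁ (refl , refl))) eq = ⊥-elim (earlier (cong π₀ eq))
    scale≡1 (inj₂ (inj₁ (_ , refl))) (inj₂ (inj₁ (refl , refl))) eq = same (cong π₁ eq)
    scale≡1 (inj₂ (inj₂ (inj₁ (_ , refl , _)))) (inj₂ (inj₁ (refl , refl))) eq = ⊥-elim (later (cong π₁ eq))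
    scale≡1 (inj₂ (inj₂ (inj₂ (_ , refl , _)))) (inj₂ (inj₁ (refl , refl))) eq = ⊥-elim (later (cong π₁ eq))
    scale≡1 (inj₁ refl) (inj₂ (inj₂ (inj₁ (refl , refl , refl)))) eq = ⊥-elim (earlier (cong π₀ eq))
    scale≡1 (inj₂ (inj₁ (_ , refl))) (inj₂ (inj₂ (inj₁ (refl , refl , refl)))) eq = ⊥-elim (earlier (cong π₁ eq))
    scale≡1 (inj₂ (inj₂ (inj₁ (_ , _ , refl)))) (inj₂ (inj₂ (inj₁ (refl , refl , refl)))) eq = same (cong π₂ eq)
    scale≡1 (inj₂ (inj₂ (inj₂ (_ , _ , refl , _)))) (inj₂ (inj₂ (inj₁ (refl , refl , refl)))) eq = ⊥-elim (later (cong π₂ eq))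
    scale≡1 (inj₁ refl) (inj₂ (inj₂ (inj₂ (refl , refl , refl , refl)))) eq = ⊥-elim (earlier (cong π₀ eq))
    scale≡1 (inj₂ (inj₁ (_ , refl))) (inj₂ (inj₂ (inj₂ (refl , refl , refl , refl)))) eq = ⊥-elim (earlier (cong π₁ eq))
    scale≡1 (inj₂ (inj₂ (inj₁ (_ , _ , refl)))) (inj₂ (inj₂ (inj₂ (refl , refl , refl , refl)))) eq = ⊥-elim (earlier (cong π₂ eq))
    scale≡1 (inj₂ (inj₂ (inj₂ (_ , _ , _ , refl)))) (inj₂ (inj₂ (inj₂ (refl , refl , refl , refl)))) eq = same (cong π₃ eq)

  ∈points-Proj⇒≡ : ∀ {X Y} → X ∈ points → Y ∈ points → Proj X Y → X ≡ Y
  ∈points-Proj⇒≡ X∈ Y∈ = Normalized-Proj⇒≡ (∈points⇒Normalized X∈) (∈points⇒Normalized Y∈)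

  module CountPoints {P : Pred V 0ℓ} (P? : Decidable P) (P-resp : ∀ {X Y} → Proj X Y → P Y → P X) where

    Count : ℕ.ℕ
    Count = length (filter P? points)

    ∈filter⁻ : ∀ {X} → X ∈ filter P? points → X ∈ points × P X
    ∈filter⁻ = ∈-filter⁻ P? {xs = points}

    count-≥ : (ws : List V) → Unique ws → (∀ a b → a ∈ ws → b ∈ ws → Proj a b → a ≡ b) →
              (∀ w → w ∈ ws → w ≢ 𝟎v × P w) → length ws ≤ Count
    count-≥ ws ws! ws-distinct good = length-≤-injection _≟V_ ws (filter P? points) ws! rep rep∈ rep-injective
      where
      rep : ∀ w → w ∈ ws → V
      rep w w∈ = proj₁ (normalize w (proj₁ (good w w∈)))
      rep∈ : ∀ w w∈ → rep w w∈ ∈ filter P? points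
      rep∈ w w∈ with normalize w (proj₁ (good w w∈))
      ... | Y , NY , w~Y = ∈-filter⁺ P? (∈points NY) (P-resp (Proj-sym w~Y) (proj₂ (good w w∈)))
      rep-injective : ∀ a b a∈ b∈ → rep a a∈ ≡ rep b b∈ → a ≡ b
      rep-injective a b a∈ b∈ eq = ws-distinct a b a∈ b∈
        (Proj-trans (proj₂ (proj₂ (normalize a _))) (subst (λ Z → Proj Z b) (sym eq) (Proj-sym (proj₂ (proj₂ (normalize b _))))))

    count-≤ : (ws : List V) → (∀ X → X ≢ 𝟎v → P X → Any (Proj X) ws) → Count ≤ length ws
    count-≤ ws cover = subst (Count ≤_) (length-tabulate (λ i → i))
      (length-≤-injection Fin._≟_ (filter P? points) (allFin (length ws)) (Unique.filter⁺ P? points-unique) position (λ _ _ → ∈-allFin _) position-injective)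
      where
      covered : ∀ X → X ∈ filter P? points → Any (Proj X) ws
      covered X X∈ = cover X (∈points⇒nonzero (proj₁ (∈filter⁻ X∈))) (proj₂ (∈filter⁻ X∈))
      position : ∀ X → X ∈ filter P? points → Fin.Fin (length ws)
      position X X∈ = Any.index (covered X X∈)
      position-injective : ∀ X Y X∈ Y∈ → position X X∈ ≡ position Y Y∈ → X ≡ Y
      position-injective X Y X∈ Y∈ eq = ∈points-Proj⇒≡ (proj₁ (∈filter⁻ X∈)) (proj₁ (∈filter⁻ Y∈))
        (Proj-trans (lookup-index (covered X X∈)) (Proj-sym (subst (λ i → Proj Y (lookup ws i)) (sym eq) (lookup-index (covered Y Y∈)))))

    count-≡ : (ws : List V) → Unique ws → (∀ a b → a ∈ ws → b ∈ ws → Proj a b → a ≡ b) →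
              (∀ w → w ∈ ws → w ≢ 𝟎v × P w) → (∀ X → X ≢ 𝟎v → P X → Any (Proj X) ws) → Count ≡ length ws
    count-≡ ws ws! ws-distinct good cover = ℕ.≤-antisym (count-≤ ws cover) (count-≥ ws ws! ws-distinct good)

  count-≤-via : ∀ {P Q : Pred V 0ℓ} (P? : Decidable P) (Q? : Decidable Q) → (∀ {X Y} → Proj X Y → Q Y → Q X) →
    (R : V → V → Set) →
    (∀ X → X ≢ 𝟎v → P X → Σ V λ c → c ≢ 𝟎v × Q c × R X c) →
    (∀ X Y c d → X ≢ 𝟎v → Y ≢ 𝟎v → P X → P Y → R X c → R Y d → Proj c d → Proj X Y) →
    length (filter P? points) ≤ length (filter Q? points)
  count-≤-via {P} {Q} P? Q? Q-resp R image determines =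
    length-≤-injection _≟V_ (filter P? points) (filter Q? points) (Unique.filter⁺ P? points-unique) f f∈ f-injective
    where
    ∈P⁻ : ∀ {X} → X ∈ filter P? points → X ∈ points × P X
    ∈P⁻ = ∈-filter⁻ P? {xs = points}
    nonzero : ∀ {X} → X ∈ filter P? points → X ≢ 𝟎v
    nonzero X∈ = ∈points⇒nonzero (proj₁ (∈P⁻ X∈))
    image′ : ∀ X → X ∈ filter P? points → Σ V λ c → c ≢ 𝟎v × Q c × R X c
    image′ X X∈ = image X (nonzero X∈) (proj₂ (∈P⁻ X∈))
    f : ∀ X → X ∈ filter P? points → V
    f X X∈ = proj₁ (normalize (proj₁ (image′ X X∈)) (proj₁ (proj₂ (image′ X X∈))))
    f∈ : ∀ X X∈ → f X X∈ ∈ filter Q? points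
    f∈ X X∈ with image′ X X∈
    ... | c , c≢0 , Qc , _ with normalize c c≢0
    ...   | d , Nd , c~d = ∈-filter⁺ Q? (∈points Nd) (Q-resp (Proj-sym c~d) Qc)
    f-injective : ∀ X Y X∈ Y∈ → f X X∈ ≡ f Y Y∈ → X ≡ Y
    f-injective X Y X∈ Y∈ eq with image′ X X∈ | image′ Y Y∈
    ... | c , c≢0 , _ , RXc | d , d≢0 , _ , RYd =
      ∈points-Proj⇒≡ (proj₁ (∈P⁻ X∈)) (proj₁ (∈P⁻ Y∈))
        (determines X Y c d (nonzero X∈) (nonzero Y∈) (proj₂ (∈P⁻ X∈)) (proj₂ (∈P⁻ Y∈)) RXc RYd
          (Proj-trans (proj₂ (proj₂ (normalize c c≢0))) (subst (λ Z → Proj Z d) (sym eq) (Proj-sym (proj₂ (proj₂ (normalize d d≢0)))))))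

-- Points, tangents and osculating planes of C are indexed by ℙ¹ = F ∪ {∞}; the planes through the
-- tangent at p are the combinations l N₁ p + m N₂ p.
module TwistedCubic (F : FiniteField) where
  open FiniteField F
  open Geom F
  open FieldProperties F
  open ProjectiveSpace F

  data ℙ¹ : Set where
    fin : Carrier → ℙ¹
    ∞ : ℙ¹

  fin-injective : ∀ {t u} → fin t ≡ fin u → t ≡ u
  fin-injective refl = refl

  point tangentVec osculating N₁ N₂ : ℙ¹ → V
  point (fin t) = curvePt t
  point ∞ = curveInf
  tangentVec (fin t) = tangentDir t
  tangentVec ∞ = tangentDirInf
  osculating (fin t) = oscPl t
  osculating ∞ = oscInf
  N₁ (fin t) = 1# , - (2# * t) , t * t , 0#
  N₁ ∞ = 0# , 0# , 1# , 0#
  N₂ (fin t) = 0# , 1# , - (2# * t) , t * t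
  N₂ ∞ = 0# , 0# , 0# , 1#

  pencilPlane : ℙ¹ → Carrier → Carrier → V
  pencilPlane p l m = (l ⊙ N₁ p) ⊕ (m ⊙ N₂ p)

  dot-pencilPlane : ∀ p l m Y → dot (pencilPlane p l m) Y ≡ l * dot (N₁ p) Y + m * dot (N₂ p) Y
  dot-pencilPlane p l m Y = dot-combinationˡ l (N₁ p) m (N₂ p) Y

  OnC : V → ℙ¹ → Set
  OnC c p = OnPlane (point p) c

  TangentIn : ℙ¹ → V → Set
  TangentIn p c = LineInPlane (point p) (tangentVec p) c

  OnTangentAt : V → ℙ¹ → Set
  OnTangentAt X p = OnLine X (point p) (tangentVec p)

  InC⇒point : ∀ {X} → InC X → Σ ℙ¹ λ p → Proj X (point p)
  InC⇒point (inj₁ (t , X~t)) = fin t , X~t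
  InC⇒point (inj₂ X~∞) = ∞ , X~∞

  point⇒InC : ∀ {X} p → Proj X (point p) → InC X
  point⇒InC (fin t) X~t = inj₁ (t , X~t)
  point⇒InC ∞ X~∞ = inj₂ X~∞

  OnTangent⇒OnTangentAt : ∀ {X} → OnTangent X → Σ ℙ¹ (OnTangentAt X)
  OnTangent⇒OnTangentAt (inj₁ (t , X∈)) = fin t , X∈
  OnTangent⇒OnTangentAt (inj₂ X∈) = ∞ , X∈

  OnTangentAt⇒OnTangent : ∀ {X} p → OnTangentAt X p → OnTangent X
  OnTangentAt⇒OnTangent (fin t) X∈ = inj₁ (t , X∈)
  OnTangentAt⇒OnTangent ∞ X∈ = inj₂ X∈

  IsOsc⇒osculating : ∀ {c} → IsOsc c → Σ ℙ¹ λ p → Proj c (osculating p)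
  IsOsc⇒osculating (inj₁ (t , c~t)) = fin t , c~t
  IsOsc⇒osculating (inj₂ c~∞) = ∞ , c~∞

  osculating⇒IsOsc : ∀ {c} p → Proj c (osculating p) → IsOsc c
  osculating⇒IsOsc (fin t) c~t = inj₁ (t , c~t)
  osculating⇒IsOsc ∞ c~∞ = inj₂ c~∞

  InC-resp : ∀ {X Y} → Proj X Y → InC Y → InC X
  InC-resp X~Y Y∈C with InC⇒point Y∈C
  ... | p , Y~p = point⇒InC p (Proj-trans X~Y Y~p)

  IsOsc-resp : ∀ {c d} → Proj c d → IsOsc d → IsOsc c
  IsOsc-resp c~d d-osc with IsOsc⇒osculating d-osc
  ... | p , d~p = osculating⇒IsOsc p (Proj-trans c~d d~p)

  point-nonzero : ∀ p → point p ≢ 𝟎v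
  point-nonzero (fin t) eq = 1≢0 (cong π₃ eq)
  point-nonzero ∞ eq = 1≢0 (cong π₀ eq)

  osculating-nonzero : ∀ p → osculating p ≢ 𝟎v
  osculating-nonzero (fin t) eq = 1≢0 (cong π₀ eq)
  osculating-nonzero ∞ eq = 1≢0 (cong π₃ eq)

  point-Proj⇒≡ : ∀ {p r} → Proj (point p) (point r) → p ≡ r
  point-Proj⇒≡ {fin s} {fin s'} (k , _ , eq) = cong fin (trans (cong π₂ eq) (trans (cong (_* s') k≡1) (*-identityˡ s')))
    where
    k≡1 : k ≡ 1#
    k≡1 = trans (sym (*-identityʳ k)) (sym (cong π₃ eq))
  point-Proj⇒≡ {fin s} {∞} (k , _ , eq) = ⊥-elim (1≢0 (trans (cong π₃ eq) (zeroʳ k)))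
  point-Proj⇒≡ {∞} {fin s} (k , k≢0 , eq) = ⊥-elim (k≢0 (trans (sym (*-identityʳ k)) (sym (cong π₃ eq))))
  point-Proj⇒≡ {∞} {∞} _ = refl

  point-injective : ∀ {p r} → point p ≡ point r → p ≡ r
  point-injective {p} eq = point-Proj⇒≡ (subst (Proj (point p)) eq (Proj-refl _))

  -- Coordinate vectors with polynomial entries, evaluating to the vectors above; the identities
  -- of this module are proved by the ring solver on them.
  module Syntax {n : ℕ} where
    Pᴾ Vᴾ : Set
    Pᴾ = Polynomial n
    Vᴾ = Pᴾ × Pᴾ × Pᴾ × Pᴾ

    dotᴾ : Vᴾ → Vᴾ → Pᴾ
    dotᴾ (a , b , c , d) (a' , b' , c' , d') = a :* a' :+ b :* b' :+ c :* c' :+ d :* d'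
    _⊙ᴾ_ : Pᴾ → Vᴾ → Vᴾ
    k ⊙ᴾ (a , b , c , d) = k :* a , k :* b , k :* c , k :* d
    _⊕ᴾ_ : Vᴾ → Vᴾ → Vᴾ
    (a , b , c , d) ⊕ᴾ (a' , b' , c' , d') = a :+ a' , b :+ b' , c :+ c' , d :+ d'
    _-ᴾ_ : Pᴾ → Pᴾ → Pᴾ
    a -ᴾ b = a :+ :- b

    curvePtᴾ tangentDirᴾ oscPlᴾ N₁ᴾ N₂ᴾ : Pᴾ → Vᴾ
    curvePtᴾ t = t :* t :* t , t :* t , t , :1
    tangentDirᴾ t = :3 :* t :* t , :2 :* t , :1 , :0
    oscPlᴾ t = :1 , :- (:3 :* t) , :3 :* t :* t , :- (t :* t :* t)
    N₁ᴾ t = :1 , :- (:2 :* t) , t :* t , :0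
    N₂ᴾ t = :0 , :1 , :- (:2 :* t) , t :* t

    curveInfᴾ tangentDirInfᴾ oscInfᴾ N₁∞ᴾ N₂∞ᴾ : Vᴾ
    curveInfᴾ = :1 , :0 , :0 , :0
    tangentDirInfᴾ = :0 , :1 , :0 , :0
    oscInfᴾ = :0 , :0 , :0 , :1
    N₁∞ᴾ = :0 , :0 , :1 , :0
    N₂∞ᴾ = :0 , :0 , :0 , :1

    pencilPlaneᴾ : Pᴾ → Pᴾ → Pᴾ → Vᴾ
    pencilPlaneᴾ t l m = (l ⊙ᴾ N₁ᴾ t) ⊕ᴾ (m ⊙ᴾ N₂ᴾ t)
    pencilPlane∞ᴾ : Pᴾ → Pᴾ → Vᴾ
    pencilPlane∞ᴾ l m = (l ⊙ᴾ N₁∞ᴾ) ⊕ᴾ (m ⊙ᴾ N₂∞ᴾ)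
  open Syntax

  pencil-point : ∀ t l m s → dot (pencilPlane (fin t) l m) (curvePt s) ≡ (s + - t) * (s + - t) * (l * s + m)
  pencil-point = solve 4 (λ t l m s → dotᴾ (pencilPlaneᴾ t l m) (curvePtᴾ s) := (s -ᴾ t) :* (s -ᴾ t) :* (l :* s :+ m)) refl
  pencil-curveInf : ∀ t l m → dot (pencilPlane (fin t) l m) curveInf ≡ l
  pencil-curveInf = solve 3 (λ t l m → dotᴾ (pencilPlaneᴾ t l m) curveInfᴾ := l) refl
  pencil-tangentDir : ∀ t l m s →
    dot (pencilPlane (fin t) l m) (tangentDir s) ≡ 2# * (s + - t) * (l * s + m) + (s + - t) * (s + - t) * l
  pencil-tangentDir = solve 4 (λ t l m s →
    dotᴾ (pencilPlaneᴾ t l m) (tangentDirᴾ s) := :2 :* (s -ᴾ t) :* (l :* s :+ m) :+ (s -ᴾ t) :* (s -ᴾ t) :* l) refl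
  pencil-tangentDirInf : ∀ t l m → dot (pencilPlane (fin t) l m) tangentDirInf ≡ m + - (2# * t * l)
  pencil-tangentDirInf = solve 3 (λ t l m → dotᴾ (pencilPlaneᴾ t l m) tangentDirInfᴾ := m -ᴾ (:2 :* t :* l)) refl
  pencil∞-point : ∀ l m s → dot (pencilPlane ∞ l m) (curvePt s) ≡ l * s + m
  pencil∞-point = solve 3 (λ l m s → dotᴾ (pencilPlane∞ᴾ l m) (curvePtᴾ s) := l :* s :+ m) refl
  pencil∞-tangentDir : ∀ l m s → dot (pencilPlane ∞ l m) (tangentDir s) ≡ l
  pencil∞-tangentDir = solve 3 (λ l m s → dotᴾ (pencilPlane∞ᴾ l m) (tangentDirᴾ s) := l) refl

  TangentIn-pencilPlane : ∀ p l m → TangentIn p (pencilPlane p l m)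
  TangentIn-pencilPlane (fin t) l m = solve 3 (λ t l m → dotᴾ (pencilPlaneᴾ t l m) (curvePtᴾ t) := :0) refl t l m ,
                                      solve 3 (λ t l m → dotᴾ (pencilPlaneᴾ t l m) (tangentDirᴾ t) := :0) refl t l m
  TangentIn-pencilPlane ∞ l m = solve 2 (λ l m → dotᴾ (pencilPlane∞ᴾ l m) curveInfᴾ := :0) refl l m ,
                                solve 2 (λ l m → dotᴾ (pencilPlane∞ᴾ l m) tangentDirInfᴾ := :0) refl l m

  TangentIn⇒pencilPlane : ∀ p c → TangentIn p c → Σ Carrier λ l → Σ Carrier λ m → c ≡ pencilPlane p l m
  TangentIn⇒pencilPlane (fin t) (c₀ , c₁ , c₂ , c₃) (t∈c , t'∈c) =
    c₀ , c₁ + 2# * t * c₀ , ≡⁴ e₀ e₁ (trans e₂ (x+0≡x t'∈c)) (trans e₃ (x+0≡x (linear-zero 1# (- t) t∈c t'∈c)))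
    where
    e₀ : c₀ ≡ c₀ * 1# + (c₁ + 2# * t * c₀) * 0#
    e₀ = solve 3 (λ c₀ c₁ t → c₀ := c₀ :* :1 :+ (c₁ :+ :2 :* t :* c₀) :* :0) refl c₀ c₁ t
    e₁ : c₁ ≡ c₀ * (- (2# * t)) + (c₁ + 2# * t * c₀) * 1#
    e₁ = solve 3 (λ c₀ c₁ t → c₁ := c₀ :* (:- (:2 :* t)) :+ (c₁ :+ :2 :* t :* c₀) :* :1) refl c₀ c₁ t
    e₂ : c₂ ≡ (c₀ * (t * t) + (c₁ + 2# * t * c₀) * (- (2# * t))) + dot (c₀ , c₁ , c₂ , c₃) (tangentDir t)
    e₂ = solve 5 (λ c₀ c₁ c₂ c₃ t →
      c₂ := (c₀ :* (t :* t) :+ (c₁ :+ :2 :* t :* c₀) :* (:- (:2 :* t))) :+ dotᴾ (c₀ , c₁ , c₂ , c₃) (tangentDirᴾ t))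
      refl c₀ c₁ c₂ c₃ t
    e₃ : c₃ ≡ (c₀ * 0# + (c₁ + 2# * t * c₀) * (t * t))
             + (1# * dot (c₀ , c₁ , c₂ , c₃) (curvePt t) + - t * dot (c₀ , c₁ , c₂ , c₃) (tangentDir t))
    e₃ = solve 5 (λ c₀ c₁ c₂ c₃ t →
      c₃ := (c₀ :* :0 :+ (c₁ :+ :2 :* t :* c₀) :* (t :* t))
            :+ (:1 :* dotᴾ (c₀ , c₁ , c₂ , c₃) (curvePtᴾ t) :+ :- t :* dotᴾ (c₀ , c₁ , c₂ , c₃) (tangentDirᴾ t)))
      refl c₀ c₁ c₂ c₃ t
  TangentIn⇒pencilPlane ∞ (c₀ , c₁ , c₂ , c₃) (∞∈c , ∞'∈c) =
    c₂ , c₃ , ≡⁴ (trans e₀ (x+0≡x ∞∈c)) (trans e₁ (x+0≡x ∞'∈c)) e₂ e₃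
    where
    e₀ : c₀ ≡ (c₂ * 0# + c₃ * 0#) + dot (c₀ , c₁ , c₂ , c₃) curveInf
    e₀ = solve 4 (λ c₀ c₁ c₂ c₃ → c₀ := (c₂ :* :0 :+ c₃ :* :0) :+ dotᴾ (c₀ , c₁ , c₂ , c₃) curveInfᴾ) refl c₀ c₁ c₂ c₃
    e₁ : c₁ ≡ (c₂ * 0# + c₃ * 0#) + dot (c₀ , c₁ , c₂ , c₃) tangentDirInf
    e₁ = solve 4 (λ c₀ c₁ c₂ c₃ → c₁ := (c₂ :* :0 :+ c₃ :* :0) :+ dotᴾ (c₀ , c₁ , c₂ , c₃) tangentDirInfᴾ) refl c₀ c₁ c₂ c₃
    e₂ : c₂ ≡ c₂ * 1# + c₃ * 0#
    e₂ = solve 2 (λ c₂ c₃ → c₂ := c₂ :* :1 :+ c₃ :* :0) refl c₂ c₃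
    e₃ : c₃ ≡ c₂ * 0# + c₃ * 1#
    e₃ = solve 2 (λ c₂ c₃ → c₃ := c₂ :* :0 :+ c₃ :* :1) refl c₂ c₃

  coefficient₁ coefficient₂ : ℙ¹ → V → Carrier
  coefficient₁ (fin t) c = π₀ c
  coefficient₁ ∞ c = π₂ c
  coefficient₂ (fin t) c = π₁ c + 2# * t * π₀ c
  coefficient₂ ∞ c = π₃ c

  coefficient₁-pencilPlane : ∀ p l m → coefficient₁ p (pencilPlane p l m) ≡ l
  coefficient₁-pencilPlane (fin t) l m = solve 2 (λ l m → l :* :1 :+ m :* :0 := l) refl l m
  coefficient₁-pencilPlane ∞ l m = solve 2 (λ l m → l :* :1 :+ m :* :0 := l) refl l m

  coefficient₂-pencilPlane : ∀ p l m → coefficient₂ p (pencilPlane p l m) ≡ m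
  coefficient₂-pencilPlane (fin t) l m = solve 3 (λ t l m →
    (l :* (:- (:2 :* t)) :+ m :* :1) :+ :2 :* t :* (l :* :1 :+ m :* :0) := m) refl t l m
  coefficient₂-pencilPlane ∞ l m = solve 2 (λ l m → l :* :0 :+ m :* :1 := m) refl l m

  coefficient₁-⊙ : ∀ p k c → coefficient₁ p (k ⊙ c) ≡ k * coefficient₁ p c
  coefficient₁-⊙ (fin t) k c = refl
  coefficient₁-⊙ ∞ k c = refl

  coefficient₂-⊙ : ∀ p k c → coefficient₂ p (k ⊙ c) ≡ k * coefficient₂ p c
  coefficient₂-⊙ (fin t) k c = solve 4 (λ t k c₀ c₁ → k :* c₁ :+ :2 :* t :* (k :* c₀) := k :* (c₁ :+ :2 :* t :* c₀)) refl t k (π₀ c) (π₁ c)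
  coefficient₂-⊙ ∞ k c = refl

  pencilPlane-⊙⇒coefficients : ∀ p {l m l' m' k} → pencilPlane p l m ≡ k ⊙ pencilPlane p l' m' → l ≡ k * l' × m ≡ k * m'
  pencilPlane-⊙⇒coefficients p {l} {m} {l'} {m'} {k} eq =
    trans (sym (coefficient₁-pencilPlane p l m))
      (trans (cong (coefficient₁ p) eq) (trans (coefficient₁-⊙ p k _) (cong (k *_) (coefficient₁-pencilPlane p l' m')))) ,
    trans (sym (coefficient₂-pencilPlane p l m))
      (trans (cong (coefficient₂ p) eq) (trans (coefficient₂-⊙ p k _) (cong (k *_) (coefficient₂-pencilPlane p l' m'))))

  pencilPlane-scale : ∀ p k l m → pencilPlane p (k * l) (k * m) ≡ k ⊙ pencilPlane p l m
  pencilPlane-scale p k l m = combination-scale k l m (N₁ p) (N₂ p)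

  pencilPlane-zero : ∀ p → pencilPlane p 0# 0# ≡ 𝟎v
  pencilPlane-zero p = trans (cong₂ (pencilPlane p) (sym (zeroˡ 0#)) (sym (zeroˡ 0#)))
                             (trans (pencilPlane-scale p 0# 0# 0#) (⊙-zeroˡ _))

  pencilPlane-nonzero : ∀ p {l m} → NotBothZero l m → pencilPlane p l m ≢ 𝟎v
  pencilPlane-nonzero p {l} {m} l,m≢0 eq with pencilPlane-⊙⇒coefficients p (trans eq (sym (⊙-zeroˡ (pencilPlane p l m))))
  ... | l≡0*l , m≡0*m = l,m≢0 (trans l≡0*l (zeroˡ l) , trans m≡0*m (zeroˡ m))

  nonzero⇒NotBothZero : ∀ {p l m c} → c ≢ 𝟎v → c ≡ pencilPlane p l m → NotBothZero l m
  nonzero⇒NotBothZero {p} c≢0 refl (refl , refl) = c≢0 (pencilPlane-zero p)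

  osculating-point : ∀ t s → dot (oscPl t) (curvePt s) ≡ (s + - t) * (s + - t) * (s + - t)
  osculating-point = solve 2 (λ t s → dotᴾ (oscPlᴾ t) (curvePtᴾ s) := (s -ᴾ t) :* (s -ᴾ t) :* (s -ᴾ t)) refl
  osculating-curveInf : ∀ t → dot (oscPl t) curveInf ≡ 1#
  osculating-curveInf = solve 1 (λ t → dotᴾ (oscPlᴾ t) curveInfᴾ := :1) refl
  osculating∞-point : ∀ s → dot oscInf (curvePt s) ≡ 1#
  osculating∞-point = solve 1 (λ s → dotᴾ oscInfᴾ (curvePtᴾ s) := :1) refl

  oscL oscM : ℙ¹ → Carrier
  oscL (fin t) = 1#
  oscL ∞ = 0#
  oscM (fin t) = - t
  oscM ∞ = 1#

  osculating≡pencilPlane : ∀ p → osculating p ≡ pencilPlane p (oscL p) (oscM p)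
  osculating≡pencilPlane (fin t) = ≡⁴ (solve 1 (λ t → :1 := :1 :* :1 :+ (:- t) :* :0) refl t)
                                      (solve 1 (λ t → :- (:3 :* t) := :1 :* (:- (:2 :* t)) :+ (:- t) :* :1) refl t)
                                      (solve 1 (λ t → :3 :* t :* t := :1 :* (t :* t) :+ (:- t) :* (:- (:2 :* t))) refl t)
                                      (solve 1 (λ t → :- (t :* t :* t) := :1 :* :0 :+ (:- t) :* (t :* t)) refl t)
  osculating≡pencilPlane ∞ = ≡⁴ (solve 0 (:0 := :0 :* :0 :+ :1 :* :0) refl) (solve 0 (:0 := :0 :* :0 :+ :1 :* :0) refl)
                                (solve 0 (:0 := :0 :* :1 :+ :1 :* :0) refl) (solve 0 (:1 := :0 :* :0 :+ :1 :* :1) refl)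

  TangentIn-osculating : ∀ p → TangentIn p (osculating p)
  TangentIn-osculating p = subst (TangentIn p) (sym (osculating≡pencilPlane p)) (TangentIn-pencilPlane p _ _)

  TangentIn-resp : ∀ {p c d} → Proj c d → TangentIn p d → TangentIn p c
  TangentIn-resp = LineInPlane-resp

  -- The pencil coefficients of the osculating plane, up to a nonzero factor.
  OscCoefficients : ℙ¹ → Carrier → Carrier → Set
  OscCoefficients (fin t) l m = l ≢ 0# × m ≡ - (l * t)
  OscCoefficients ∞ l m = l ≡ 0#

  OscCoefficients? : ∀ p l m → Dec (OscCoefficients p l m)
  OscCoefficients? (fin t) l m = ¬? (l ≟ 0#) ×-dec (m ≟ (- (l * t)))
  OscCoefficients? ∞ l m = l ≟ 0#

  OscCoefficients⇒osculating : ∀ p {l m} → NotBothZero l m → OscCoefficients p l m → Proj (pencilPlane p l m) (osculating p)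
  OscCoefficients⇒osculating (fin t) {l} {m} _ (l≢0 , refl) = l , l≢0 ,
    trans (cong₂ (pencilPlane (fin t)) (sym (*-identityʳ l)) (solve 2 (λ l t → :- (l :* t) := l :* (:- t)) refl l t))
          (trans (pencilPlane-scale (fin t) l 1# (- t)) (cong (l ⊙_) (sym (osculating≡pencilPlane (fin t)))))
  OscCoefficients⇒osculating ∞ {l} {m} l,m≢0 refl = m , (λ m≡0 → l,m≢0 (refl , m≡0)) ,
    trans (cong₂ (pencilPlane ∞) (sym (zeroʳ m)) (sym (*-identityʳ m)))
          (trans (pencilPlane-scale ∞ m 0# 1#) (cong (m ⊙_) (sym (osculating≡pencilPlane ∞))))

  PointOfCIn : V → V → Set
  PointOfCIn c X = OnPlane X c × InC X

  PointOfCIn-resp : ∀ c {X Y} → Proj X Y → PointOfCIn c Y → PointOfCIn c X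
  PointOfCIn-resp c X~Y (Y∈c , Y∈C) = OnPlane-respˡ X~Y Y∈c , InC-resp X~Y Y∈C

  module PointsOfCIn (c : V) = CountPoints (λ X → OnPlane? X c ×-dec InC? X) (PointOfCIn-resp c)

  map-point-nonproportional : ∀ (ps : List ℙ¹) a b → a ∈ map point ps → b ∈ map point ps → Proj a b → a ≡ b
  map-point-nonproportional ps a b a∈ b∈ a~b with ∈-map⁻ point a∈ | ∈-map⁻ point b∈
  ... | p , _ , refl | r , _ , refl = cong point (point-Proj⇒≡ a~b)

  length≤nCOnPlane : ∀ c (ps : List ℙ¹) → Unique ps → All (OnC c) ps → length ps ≤ nCOnPlane c
  length≤nCOnPlane c ps ps! ps∈c = subst (_≤ nCOnPlane c) (length-map point ps)
    (PointsOfCIn.count-≥ c (map point ps) (Unique.map⁺ point-injective ps!) (map-point-nonproportional ps) good)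
    where
    good : ∀ w → w ∈ map point ps → w ≢ 𝟎v × PointOfCIn c w
    good w w∈ with ∈-map⁻ point w∈
    ... | p , p∈ , refl = point-nonzero p , All.lookup ps∈c p∈ , point⇒InC p (Proj-refl _)

  nCOnPlane≡length : ∀ c (ps : List ℙ¹) → Unique ps → All (OnC c) ps → (∀ s → OnC c s → s ∈ ps) → nCOnPlane c ≡ length ps
  nCOnPlane≡length c ps ps! ps∈c complete-ps = ℕ.≤-antisym
    (subst (nCOnPlane c ≤_) (length-map point ps) (PointsOfCIn.count-≤ c (map point ps) cover))
    (length≤nCOnPlane c ps ps! ps∈c)
    where
    cover : ∀ X → X ≢ 𝟎v → PointOfCIn c X → Any (Proj X) (map point ps)
    cover X _ (X∈c , X∈C) with InC⇒point X∈C
    ... | s , X~s = Any.map (λ { refl → X~s }) (∈-map⁺ point (complete-ps s (OnPlane-respˡ (Proj-sym X~s) X∈c)))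

  nCOnPlane-resp : ∀ {c d} → Proj c d → nCOnPlane c ≡ nCOnPlane d
  nCOnPlane-resp {c} {d} c~d = cong length (filter-≐ (λ X → OnPlane? X c ×-dec InC? X) (λ X → OnPlane? X d ×-dec InC? X)
    ((λ (X∈c , X∈C) → OnPlane-respʳ (Proj-sym c~d) X∈c , X∈C) , (λ (X∈d , X∈C) → OnPlane-respʳ c~d X∈d , X∈C)) points)

  Two-C-resp : ∀ {c d} → Proj c d → Two-C d → Two-C c
  Two-C-resp c~d d-2C = trans (nCOnPlane-resp c~d) d-2C

  nCOnPlane-osculating : ∀ p → nCOnPlane (osculating p) ≡ 1
  nCOnPlane-osculating p = nCOnPlane≡length (osculating p) (p ∷ []) ([] ∷ []) (proj₁ (TangentIn-osculating p) ∷ []) (only p)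
    where
    only : ∀ p s → OnC (osculating p) s → s ∈ p ∷ []
    only (fin t) (fin s) s∈ with s ≟ t
    ... | yes refl = here refl
    ... | no s≢t = ⊥-elim (x≢y⇒x-y≢0 s≢t (x³≡0⇒x≡0 (trans (sym (osculating-point t s)) s∈)))
    only (fin t) ∞ ∞∈ = ⊥-elim (1≢0 (trans (sym (osculating-curveInf t)) ∞∈))
    only ∞ (fin s) s∈ = ⊥-elim (1≢0 (trans (sym (osculating∞-point s)) s∈))
    only ∞ ∞ _ = here refl

  osculating⇒¬Two-C : ∀ {c} p → Proj c (osculating p) → ¬ Two-C c
  osculating⇒¬Two-C p c~p c-2C = 2≢1 (trans (sym c-2C) (trans (nCOnPlane-resp c~p) (nCOnPlane-osculating p)))
    where
    2≢1 : 2 ≢ 1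
    2≢1 ()

  nCOnPlane-pencilPlane : ∀ p l m → NotBothZero l m → ¬ OscCoefficients p l m → nCOnPlane (pencilPlane p l m) ≡ 2
  nCOnPlane-pencilPlane (fin t) l m l,m≢0 ¬osc with l ≟ 0#
  ... | yes refl = nCOnPlane≡length (pencilPlane (fin t) 0# m) (fin t ∷ ∞ ∷ []) (pair-unique λ ())
        (proj₁ (TangentIn-pencilPlane (fin t) 0# m) ∷ pencil-curveInf t 0# m ∷ []) only
    where
    only : ∀ s → OnC (pencilPlane (fin t) 0# m) s → s ∈ fin t ∷ ∞ ∷ []
    only (fin s) s∈ = [ (λ s-t≡0 → here (cong fin (x-y≡0⇒x≡y s-t≡0)))
                      , (λ 0s+m≡0 → ⊥-elim (l,m≢0 (refl , trans (sym (0*x+y≡y s m)) 0s+m≡0))) ]′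
                      (x²y≡0 (trans (sym (pencil-point t 0# m s)) s∈))
    only ∞ _ = there (here refl)
  ... | no l≢0 = nCOnPlane≡length (pencilPlane (fin t) l m) (fin t ∷ fin u ∷ []) (pair-unique t≢u)
        (proj₁ (TangentIn-pencilPlane (fin t) l m) ∷ trans (pencil-point t l m u) (trans (cong ((u + - t) * (u + - t) *_) (root-isRoot l m l≢0)) (zeroʳ _)) ∷ [])
        only
    where
    u : Carrier
    u = root l m l≢0
    t≢u : fin t ≢ fin u
    t≢u t≡u = ¬osc (l≢0 , subst (λ z → m ≡ - (l * z)) (sym (fin-injective t≡u)) (root⇒coefficient (root-isRoot l m l≢0)))
    only : ∀ s → OnC (pencilPlane (fin t) l m) s → s ∈ fin t ∷ fin u ∷ []
    only (fin s) s∈ = [ (λ s-t≡0 → here (cong fin (x-y≡0⇒x≡y s-t≡0)))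
                      , (λ ls+m≡0 → there (here (cong fin (root-unique l≢0 ls+m≡0 (root-isRoot l m l≢0))))) ]′
                      (x²y≡0 (trans (sym (pencil-point t l m s)) s∈))
    only ∞ ∞∈ = ⊥-elim (l≢0 (trans (sym (pencil-curveInf t l m)) ∞∈))
  nCOnPlane-pencilPlane ∞ l m _ l≢0 = nCOnPlane≡length (pencilPlane ∞ l m) (∞ ∷ fin u ∷ []) (pair-unique λ ())
      (proj₁ (TangentIn-pencilPlane ∞ l m) ∷ trans (pencil∞-point l m u) (root-isRoot l m l≢0) ∷ []) only
    where
    u : Carrier
    u = root l m l≢0
    only : ∀ s → OnC (pencilPlane ∞ l m) s → s ∈ ∞ ∷ fin u ∷ []
    only (fin s) s∈ = there (here (cong fin (root-unique l≢0 (trans (sym (pencil∞-point l m s)) s∈) (root-isRoot l m l≢0))))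
    only ∞ _ = here refl

  pencilPlane-osculating-or-Two-C : ∀ p l m → NotBothZero l m → Proj (pencilPlane p l m) (osculating p) ⊎ Two-C (pencilPlane p l m)
  pencilPlane-osculating-or-Two-C p l m l,m≢0 with OscCoefficients? p l m
  ... | yes osc = inj₁ (OscCoefficients⇒osculating p l,m≢0 osc)
  ... | no ¬osc = inj₂ (nCOnPlane-pencilPlane p l m l,m≢0 ¬osc)

  TangentIn⇒IsOsc-or-Two-C : ∀ p c → c ≢ 𝟎v → TangentIn p c → IsOsc c ⊎ Two-C c
  TangentIn⇒IsOsc-or-Two-C p c c≢0 p⊆c with TangentIn⇒pencilPlane p c p⊆c
  ... | l , m , refl with pencilPlane-osculating-or-Two-C p l m (nonzero⇒NotBothZero {p} c≢0 refl)
  ...   | inj₁ c~osc = inj₁ (osculating⇒IsOsc p c~osc)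
  ...   | inj₂ c-2C = inj₂ c-2C

  dot-curveInf : ∀ c → dot c curveInf ≡ π₀ c
  dot-curveInf (c₀ , c₁ , c₂ , c₃) = solve 4 (λ c₀ c₁ c₂ c₃ → dotᴾ (c₀ , c₁ , c₂ , c₃) curveInfᴾ := c₀) refl c₀ c₁ c₂ c₃

  dot-tangentDirInf : ∀ c → dot c tangentDirInf ≡ π₁ c
  dot-tangentDirInf (c₀ , c₁ , c₂ , c₃) =
    solve 4 (λ c₀ c₁ c₂ c₃ → dotᴾ (c₀ , c₁ , c₂ , c₃) tangentDirInfᴾ := c₁) refl c₀ c₁ c₂ c₃

  NoThirdPoint : V → ℙ¹ → ℙ¹ → Set
  NoThirdPoint c p r = ∀ w → w ≢ p → w ≢ r → ¬ OnC c w

  -- For s ∈ {t, u, w} the cubic c₀ s³ + c₁ s² + c₂ s + c₃ equals γ s² + α s + β (Vieta: s³ = e₁ s² − e₂ s + e₃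
  -- with eᵢ the elementary symmetric functions of t, u, w); choosing w with γ = 0 makes it linear.
  module TwoFinitePoints (c₀ c₁ c₂ c₃ t u w : Carrier) where
    c : V
    c = c₀ , c₁ , c₂ , c₃
    γ α β : Carrier
    γ = c₁ + c₀ * (t + u + w)
    α = c₂ + - (c₀ * (t * u + t * w + u * w))
    β = c₃ + c₀ * t * u * w

    γᴾ αᴾ βᴾ : ∀ {n} → Polynomial n → Polynomial n → Polynomial n → Polynomial n → Polynomial n → Polynomial n → Polynomial n → Polynomial n
    γᴾ c₀ c₁ c₂ c₃ t u w = c₁ :+ c₀ :* (t :+ u :+ w)
    αᴾ c₀ c₁ c₂ c₃ t u w = c₂ :+ :- (c₀ :* (t :* u :+ t :* w :+ u :* w))
    βᴾ c₀ c₁ c₂ c₃ t u w = c₃ :+ c₀ :* t :* u :* w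

    at-t : dot c (curvePt t) ≡ γ * (t * t) + (α * t + β)
    at-t = solve 7 (λ c₀ c₁ c₂ c₃ t u w → dotᴾ (c₀ , c₁ , c₂ , c₃) (curvePtᴾ t)
      := γᴾ c₀ c₁ c₂ c₃ t u w :* (t :* t) :+ (αᴾ c₀ c₁ c₂ c₃ t u w :* t :+ βᴾ c₀ c₁ c₂ c₃ t u w)) refl c₀ c₁ c₂ c₃ t u w
    at-u : dot c (curvePt u) ≡ γ * (u * u) + (α * u + β)
    at-u = solve 7 (λ c₀ c₁ c₂ c₃ t u w → dotᴾ (c₀ , c₁ , c₂ , c₃) (curvePtᴾ u)
      := γᴾ c₀ c₁ c₂ c₃ t u w :* (u :* u) :+ (αᴾ c₀ c₁ c₂ c₃ t u w :* u :+ βᴾ c₀ c₁ c₂ c₃ t u w)) refl c₀ c₁ c₂ c₃ t u w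
    at-w : dot c (curvePt w) ≡ γ * (w * w) + (α * w + β)
    at-w = solve 7 (λ c₀ c₁ c₂ c₃ t u w → dotᴾ (c₀ , c₁ , c₂ , c₃) (curvePtᴾ w)
      := γᴾ c₀ c₁ c₂ c₃ t u w :* (w :* w) :+ (αᴾ c₀ c₁ c₂ c₃ t u w :* w :+ βᴾ c₀ c₁ c₂ c₃ t u w)) refl c₀ c₁ c₂ c₃ t u w
    tangent-at-t : dot c (tangentDir t) ≡ 2# * γ * t + α + c₀ * (t + - u) * (t + - w)
    tangent-at-t = solve 7 (λ c₀ c₁ c₂ c₃ t u w → dotᴾ (c₀ , c₁ , c₂ , c₃) (tangentDirᴾ t)
      := :2 :* γᴾ c₀ c₁ c₂ c₃ t u w :* t :+ αᴾ c₀ c₁ c₂ c₃ t u w :+ c₀ :* (t -ᴾ u) :* (t -ᴾ w)) refl c₀ c₁ c₂ c₃ t u w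
    tangent-at-u : dot c (tangentDir u) ≡ 2# * γ * u + α + c₀ * (u + - t) * (u + - w)
    tangent-at-u = solve 7 (λ c₀ c₁ c₂ c₃ t u w → dotᴾ (c₀ , c₁ , c₂ , c₃) (tangentDirᴾ u)
      := :2 :* γᴾ c₀ c₁ c₂ c₃ t u w :* u :+ αᴾ c₀ c₁ c₂ c₃ t u w :+ c₀ :* (u -ᴾ t) :* (u -ᴾ w)) refl c₀ c₁ c₂ c₃ t u w

  private
    0*x+y : ∀ {g} x y → g ≡ 0# → g * x + y ≡ y
    0*x+y x y refl = 0*x+y≡y x y

    x+y*0 : ∀ x {y z} → z ≡ 0# → x + y * z ≡ x
    x+y*0 x {y} refl = trans (cong (x +_) (zeroʳ y)) (+-identityʳ x)

    x*0+y : ∀ x {z} y → z ≡ 0# → x * z + y ≡ y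
    x*0+y x y refl = trans (cong (_+ y) (zeroʳ x)) (+-identityˡ y)

    x-0 : ∀ x {e} → e ≡ 0# → x + - e ≡ x
    x-0 x refl = trans (cong (x +_) -0≡0) (+-identityʳ x)

  two-finite⇒tangent : ∀ c₀ c₁ c₂ c₃ t u → let c = (c₀ , c₁ , c₂ , c₃) in
    t ≢ u → OnC c (fin t) → OnC c (fin u) → NoThirdPoint c (fin t) (fin u) → Σ ℙ¹ λ p → TangentIn p c
  two-finite⇒tangent c₀ c₁ c₂ c₃ t u t≢u t∈c u∈c no-third with c₀ ≟ 0#
  ... | yes c₀≡0 = ⊥-elim (no-third ∞ (λ ()) (λ ()) (trans (dot-curveInf _) c₀≡0))
  ... | no c₀≢0 = tangent
    where
    w : Carrier
    w = - (c₁ * inv c₀ c₀≢0) + - t + - u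
    open TwoFinitePoints c₀ c₁ c₂ c₃ t u w
    γ≡0 : γ ≡ 0#
    γ≡0 = trans (solve 5 (λ c₀ c₁ t u i → c₁ :+ c₀ :* (t :+ u :+ (:- (c₁ :* i) :+ :- t :+ :- u)) := c₁ :+ :- (c₁ :* (c₀ :* i)))
                         refl c₀ c₁ t u (inv c₀ c₀≢0))
                (trans (cong (λ z → c₁ + - (c₁ * z)) (*-inverseʳ c₀ c₀≢0)) (trans (cong (λ z → c₁ + - z) (*-identityʳ c₁)) (-‿inverseʳ c₁)))
    αt+β≡0 : α * t + β ≡ 0#
    αt+β≡0 = trans (sym (0*x+y (t * t) _ γ≡0)) (trans (sym at-t) t∈c)
    αu+β≡0 : α * u + β ≡ 0#
    αu+β≡0 = trans (sym (0*x+y (u * u) _ γ≡0)) (trans (sym at-u) u∈c)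
    α≡0 : α ≡ 0#
    α≡0 with α ≟ 0#
    ... | yes α≡0 = α≡0
    ... | no α≢0 = ⊥-elim (t≢u (root-unique α≢0 αt+β≡0 αu+β≡0))
    β≡0 : β ≡ 0#
    β≡0 = trans (sym (0*x+y t β α≡0)) αt+β≡0
    w∈c : OnC c (fin w)
    w∈c = trans at-w (trans (0*x+y (w * w) _ γ≡0) (trans (0*x+y w β α≡0) β≡0))
    2γx+α≡0 : ∀ x → 2# * γ * x + α ≡ 0#
    2γx+α≡0 x = trans (cong₂ (λ g a → 2# * g * x + a) γ≡0 α≡0) (solve 1 (λ x → :2 :* :0 :* x :+ :0 := :0) refl x)
    tangent : Σ ℙ¹ λ p → TangentIn p c
    tangent with w ≟ t | w ≟ u
    ... | yes w≡t | _ = fin t , t∈c , trans tangent-at-t (trans (x+y*0 _ (x≡y⇒x-y≡0 (sym w≡t))) (2γx+α≡0 t))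
    ... | no _ | yes w≡u = fin u , u∈c , trans tangent-at-u (trans (x+y*0 _ (x≡y⇒x-y≡0 (sym w≡u))) (2γx+α≡0 u))
    ... | no w≢t | no w≢u = ⊥-elim (no-third (fin w) (λ eq → w≢t (fin-injective eq)) (λ eq → w≢u (fin-injective eq)) w∈c)

  -- As above, for a plane through ∞ (c₀ = 0) the quadratic c₁ s² + c₂ s + c₃ equals γ s + β for s ∈ {t, w}.
  module FiniteAndInfinitePoint (c₀ c₁ c₂ c₃ t w : Carrier) where
    c : V
    c = c₀ , c₁ , c₂ , c₃
    γ β : Carrier
    γ = c₂ + c₁ * (t + w)
    β = c₃ + - (c₁ * t * w)

    γᴾ βᴾ : ∀ {n} → Polynomial n → Polynomial n → Polynomial n → Polynomial n → Polynomial n → Polynomial n → Polynomial n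
    γᴾ c₀ c₁ c₂ c₃ t w = c₂ :+ c₁ :* (t :+ w)
    βᴾ c₀ c₁ c₂ c₃ t w = c₃ :+ :- (c₁ :* t :* w)

    at-t : dot c (curvePt t) ≡ c₀ * (t * t * t) + (γ * t + β)
    at-t = solve 6 (λ c₀ c₁ c₂ c₃ t w → dotᴾ (c₀ , c₁ , c₂ , c₃) (curvePtᴾ t)
      := c₀ :* (t :* t :* t) :+ (γᴾ c₀ c₁ c₂ c₃ t w :* t :+ βᴾ c₀ c₁ c₂ c₃ t w)) refl c₀ c₁ c₂ c₃ t w
    at-w : dot c (curvePt w) ≡ c₀ * (w * w * w) + (γ * w + β)
    at-w = solve 6 (λ c₀ c₁ c₂ c₃ t w → dotᴾ (c₀ , c₁ , c₂ , c₃) (curvePtᴾ w)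
      := c₀ :* (w :* w :* w) :+ (γᴾ c₀ c₁ c₂ c₃ t w :* w :+ βᴾ c₀ c₁ c₂ c₃ t w)) refl c₀ c₁ c₂ c₃ t w
    tangent-at-t : dot c (tangentDir t) ≡ c₀ * (3# * t * t) + γ + c₁ * (t + - w)
    tangent-at-t = solve 6 (λ c₀ c₁ c₂ c₃ t w → dotᴾ (c₀ , c₁ , c₂ , c₃) (tangentDirᴾ t)
      := c₀ :* (:3 :* t :* t) :+ γᴾ c₀ c₁ c₂ c₃ t w :+ c₁ :* (t -ᴾ w)) refl c₀ c₁ c₂ c₃ t w

  finite-and-∞⇒tangent : ∀ c₀ c₁ c₂ c₃ t → let c = (c₀ , c₁ , c₂ , c₃) in
    OnC c (fin t) → OnC c ∞ → NoThirdPoint c (fin t) ∞ → Σ ℙ¹ λ p → TangentIn p c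
  finite-and-∞⇒tangent c₀ c₁ c₂ c₃ t t∈c ∞∈c no-third with c₁ ≟ 0#
  ... | yes c₁≡0 = ∞ , ∞∈c , trans (dot-tangentDirInf _) c₁≡0
  ... | no c₁≢0 = tangent
    where
    w : Carrier
    w = - (c₂ * inv c₁ c₁≢0) + - t
    open FiniteAndInfinitePoint c₀ c₁ c₂ c₃ t w
    c₀≡0 : c₀ ≡ 0#
    c₀≡0 = trans (sym (dot-curveInf _)) ∞∈c
    γ≡0 : γ ≡ 0#
    γ≡0 = trans (solve 4 (λ c₁ c₂ t i → c₂ :+ c₁ :* (t :+ (:- (c₂ :* i) :+ :- t)) := c₂ :+ :- (c₂ :* (c₁ :* i)))
                         refl c₁ c₂ t (inv c₁ c₁≢0))
                (trans (cong (λ z → c₂ + - (c₂ * z)) (*-inverseʳ c₁ c₁≢0)) (trans (cong (λ z → c₂ + - z) (*-identityʳ c₂)) (-‿inverseʳ c₂)))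
    β≡0 : β ≡ 0#
    β≡0 = trans (sym (0*x+y t _ γ≡0)) (trans (sym (0*x+y (t * t * t) _ c₀≡0)) (trans (sym at-t) t∈c))
    w∈c : OnC c (fin w)
    w∈c = trans at-w (trans (0*x+y (w * w * w) _ c₀≡0) (trans (0*x+y w _ γ≡0) β≡0))
    tangent : Σ ℙ¹ λ p → TangentIn p c
    tangent with w ≟ t
    ... | yes w≡t = fin t , t∈c ,
      trans tangent-at-t (trans (x+y*0 _ (x≡y⇒x-y≡0 (sym w≡t))) (trans (0*x+y (3# * t * t) _ c₀≡0) γ≡0))
    ... | no w≢t = ⊥-elim (no-third (fin w) (λ eq → w≢t (fin-injective eq)) (λ ()) w∈c)

  two-points⇒tangent : ∀ c p r → p ≢ r → OnC c p → OnC c r → NoThirdPoint c p r → Σ ℙ¹ λ p → TangentIn p c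
  two-points⇒tangent (c₀ , c₁ , c₂ , c₃) (fin t) (fin u) t≢u = two-finite⇒tangent c₀ c₁ c₂ c₃ t u (λ t≡u → t≢u (cong fin t≡u))
  two-points⇒tangent (c₀ , c₁ , c₂ , c₃) (fin t) ∞ _ = finite-and-∞⇒tangent c₀ c₁ c₂ c₃ t
  two-points⇒tangent (c₀ , c₁ , c₂ , c₃) ∞ (fin u) _ ∞∈c u∈c no-third =
    finite-and-∞⇒tangent c₀ c₁ c₂ c₃ u u∈c ∞∈c (λ w w≢u w≢∞ → no-third w w≢∞ w≢u)
  two-points⇒tangent c ∞ ∞ ∞≢∞ = ⊥-elim (∞≢∞ refl)

  Two-C⇒tangent : ∀ c → Two-C c → Σ ℙ¹ λ p → TangentIn p c
  Two-C⇒tangent c c-2C with length≡2⇒distinct-pair _ c-2C (Unique.filter⁺ (λ X → OnPlane? X c ×-dec InC? X) points-unique)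
  ... | X , Y , X∈ , Y∈ , X≢Y = two-points⇒tangent c p r p≢r p∈c r∈c no-third
    where
    open PointsOfCIn c using (∈filter⁻)
    X-on Y-on : Σ ℙ¹ λ p → Proj _ (point p)
    X-on = InC⇒point (proj₂ (proj₂ (∈filter⁻ X∈)))
    Y-on = InC⇒point (proj₂ (proj₂ (∈filter⁻ Y∈)))
    p r : ℙ¹
    p = proj₁ X-on
    r = proj₁ Y-on
    p∈c : OnC c p
    p∈c = OnPlane-respˡ (Proj-sym (proj₂ X-on)) (proj₁ (proj₂ (∈filter⁻ X∈)))
    r∈c : OnC c r
    r∈c = OnPlane-respˡ (Proj-sym (proj₂ Y-on)) (proj₁ (proj₂ (∈filter⁻ Y∈)))
    p≢r : p ≢ r
    p≢r p≡r = X≢Y (∈points-Proj⇒≡ (proj₁ (∈filter⁻ X∈)) (proj₁ (∈filter⁻ Y∈))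
      (Proj-trans (proj₂ X-on) (Proj-sym (subst (λ z → Proj Y (point z)) (sym p≡r) (proj₂ Y-on)))))
    3≰2 : ¬ 3 ≤ 2
    3≰2 (s≤s (s≤s ()))
    no-third : NoThirdPoint c p r
    no-third w w≢p w≢r w∈c = 3≰2 (ℕ.≤-trans
      (length≤nCOnPlane c (p ∷ r ∷ w ∷ []) ((p≢r ∷ (λ p≡w → w≢p (sym p≡w)) ∷ []) ∷ ((λ r≡w → w≢r (sym r≡w)) ∷ []) ∷ [] ∷ [])
        (p∈c ∷ r∈c ∷ w∈c ∷ [])) (ℕ.≤-reflexive c-2C))

  pencilPlane-tangents-unique : ∀ p r {l m} → NotBothZero l m → TangentIn r (pencilPlane p l m) → p ≡ r
  pencilPlane-tangents-unique (fin t) (fin u) {l} {m} l,m≢0 (u∈c , u'∈c) with t ≟ u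
  ... | yes t≡u = cong fin t≡u
  ... | no t≢u = [ u≡t , (λ lu+m≡0 → [ u≡t , (λ l≡0 → ⊥-elim (l,m≢0 (l≡0 , m≡0 lu+m≡0 l≡0))) ]′ (x²y≡0 (tangent-eq lu+m≡0))) ]′
                   (x²y≡0 (trans (sym (pencil-point t l m u)) u∈c))
    where
    u≡t : ∀ {A : Set} → u + - t ≡ 0# → A
    u≡t u-t≡0 = ⊥-elim (t≢u (sym (x-y≡0⇒x≡y u-t≡0)))
    m≡0 : l * u + m ≡ 0# → l ≡ 0# → m ≡ 0#
    m≡0 lu+m≡0 refl = trans (sym (0*x+y≡y u m)) lu+m≡0
    tangent-eq : l * u + m ≡ 0# → (u + - t) * (u + - t) * l ≡ 0#
    tangent-eq lu+m≡0 = trans (sym (x*0+y (2# * (u + - t)) _ lu+m≡0))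
                              (trans (sym (pencil-tangentDir t l m u)) u'∈c)
  pencilPlane-tangents-unique (fin t) ∞ {l} {m} l,m≢0 (∞∈c , ∞'∈c) = ⊥-elim (l,m≢0 (l≡0 , m≡0))
    where
    l≡0 : l ≡ 0#
    l≡0 = trans (sym (pencil-curveInf t l m)) ∞∈c
    m≡0 : m ≡ 0#
    m≡0 = trans (sym (x-0 m (trans (cong (2# * t *_) l≡0) (zeroʳ _)))) (trans (sym (pencil-tangentDirInf t l m)) ∞'∈c)
  pencilPlane-tangents-unique ∞ (fin u) {l} {m} l,m≢0 (u∈c , u'∈c) =
    ⊥-elim (l,m≢0 (l≡0 , trans (sym (0*x+y u m l≡0)) (trans (sym (pencil∞-point l m u)) u∈c)))
    where
    l≡0 : l ≡ 0#
    l≡0 = trans (sym (pencil∞-tangentDir l m u)) u'∈c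
  pencilPlane-tangents-unique ∞ ∞ _ _ = refl

  TangentIn-unique : ∀ p r c → c ≢ 𝟎v → TangentIn p c → TangentIn r c → p ≡ r
  TangentIn-unique p r c c≢0 p⊆c r⊆c with TangentIn⇒pencilPlane p c p⊆c
  ... | l , m , refl = pencilPlane-tangents-unique p r (nonzero⇒NotBothZero {p} c≢0 refl) r⊆c

  TangentIn-N₁ : ∀ p → TangentIn p (N₁ p)
  TangentIn-N₁ (fin t) = solve 1 (λ t → dotᴾ (N₁ᴾ t) (curvePtᴾ t) := :0) refl t , solve 1 (λ t → dotᴾ (N₁ᴾ t) (tangentDirᴾ t) := :0) refl t
  TangentIn-N₁ ∞ = solve 0 (dotᴾ N₁∞ᴾ curveInfᴾ := :0) refl , solve 0 (dotᴾ N₁∞ᴾ tangentDirInfᴾ := :0) refl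

  TangentIn-N₂ : ∀ p → TangentIn p (N₂ p)
  TangentIn-N₂ (fin t) = solve 1 (λ t → dotᴾ (N₂ᴾ t) (curvePtᴾ t) := :0) refl t , solve 1 (λ t → dotᴾ (N₂ᴾ t) (tangentDirᴾ t) := :0) refl t
  TangentIn-N₂ ∞ = solve 0 (dotᴾ N₂∞ᴾ curveInfᴾ := :0) refl , solve 0 (dotᴾ N₂∞ᴾ tangentDirInfᴾ := :0) refl

  N₁∩N₂⇒OnTangentAt : ∀ p X → OnPlane X (N₁ p) → OnPlane X (N₂ p) → OnTangentAt X p
  N₁∩N₂⇒OnTangentAt (fin t) X@(x₀ , x₁ , x₂ , x₃) X∈N₁ X∈N₂ =
    x₃ , x₂ + - (t * x₃) , ≡⁴ (trans e₀ (x+0≡x (linear-zero 1# (2# * t) X∈N₁ X∈N₂))) (trans e₁ (x+0≡x X∈N₂)) e₂ e₃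
    where
    e₀ : x₀ ≡ (x₃ * (t * t * t) + (x₂ + - (t * x₃)) * (3# * t * t)) + (1# * dot (N₁ (fin t)) X + 2# * t * dot (N₂ (fin t)) X)
    e₀ = solve 5 (λ t x₀ x₁ x₂ x₃ → x₀ := (x₃ :* (t :* t :* t) :+ (x₂ :+ :- (t :* x₃)) :* (:3 :* t :* t))
      :+ (:1 :* dotᴾ (N₁ᴾ t) (x₀ , x₁ , x₂ , x₃) :+ :2 :* t :* dotᴾ (N₂ᴾ t) (x₀ , x₁ , x₂ , x₃))) refl t x₀ x₁ x₂ x₃
    e₁ : x₁ ≡ (x₃ * (t * t) + (x₂ + - (t * x₃)) * (2# * t)) + dot (N₂ (fin t)) X
    e₁ = solve 5 (λ t x₀ x₁ x₂ x₃ → x₁ := (x₃ :* (t :* t) :+ (x₂ :+ :- (t :* x₃)) :* (:2 :* t)) :+ dotᴾ (N₂ᴾ t) (x₀ , x₁ , x₂ , x₃))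
      refl t x₀ x₁ x₂ x₃
    e₂ : x₂ ≡ x₃ * t + (x₂ + - (t * x₃)) * 1#
    e₂ = solve 3 (λ t x₂ x₃ → x₂ := x₃ :* t :+ (x₂ :+ :- (t :* x₃)) :* :1) refl t x₂ x₃
    e₃ : x₃ ≡ x₃ * 1# + (x₂ + - (t * x₃)) * 0#
    e₃ = solve 3 (λ t x₂ x₃ → x₃ := x₃ :* :1 :+ (x₂ :+ :- (t :* x₃)) :* :0) refl t x₂ x₃
  N₁∩N₂⇒OnTangentAt ∞ X@(x₀ , x₁ , x₂ , x₃) X∈N₁ X∈N₂ =
    x₀ , x₁ , ≡⁴ e₀ e₁ (trans e₂ (x+0≡x X∈N₁)) (trans e₃ (x+0≡x X∈N₂))
    where
    e₀ : x₀ ≡ x₀ * 1# + x₁ * 0#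
    e₀ = solve 2 (λ x₀ x₁ → x₀ := x₀ :* :1 :+ x₁ :* :0) refl x₀ x₁
    e₁ : x₁ ≡ x₀ * 0# + x₁ * 1#
    e₁ = solve 2 (λ x₀ x₁ → x₁ := x₀ :* :0 :+ x₁ :* :1) refl x₀ x₁
    e₂ : x₂ ≡ (x₀ * 0# + x₁ * 0#) + dot (N₁ ∞) X
    e₂ = solve 4 (λ x₀ x₁ x₂ x₃ → x₂ := (x₀ :* :0 :+ x₁ :* :0) :+ dotᴾ N₁∞ᴾ (x₀ , x₁ , x₂ , x₃)) refl x₀ x₁ x₂ x₃
    e₃ : x₃ ≡ (x₀ * 0# + x₁ * 0#) + dot (N₂ ∞) X
    e₃ = solve 4 (λ x₀ x₁ x₂ x₃ → x₃ := (x₀ :* :0 :+ x₁ :* :0) :+ dotᴾ N₂∞ᴾ (x₀ , x₁ , x₂ , x₃)) refl x₀ x₁ x₂ x₃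

  OnTangentAt⇒off-C-coefficient≢0 : ∀ {X p a b} → X ≢ 𝟎v → ¬ InC X → X ≡ (a ⊙ point p) ⊕ (b ⊙ tangentVec p) → b ≢ 0#
  OnTangentAt⇒off-C-coefficient≢0 {X} {p} {a} X≢0 X∉C X≡ refl = X∉C (point⇒InC p (a , a≢0 , trans X≡ (combination-zeroʳ a (point p) (tangentVec p))))
    where
    a≢0 : a ≢ 0#
    a≢0 refl = X≢0 (trans X≡ (trans (combination-zeroʳ 0# (point p) (tangentVec p)) (⊙-zeroˡ (point p))))

  -- Eliminating a between the four coordinate equations of a ⊙ point t + b ⊙ tangent t = a ⊙ point u + b' ⊙ tangent u.
  tangents-meet⇒ : ∀ a b b' t u → a * (t * t * t) + b * (3# * t * t) ≡ a * (u * u * u) + b' * (3# * u * u) →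
    a * (t * t) + b * (2# * t) ≡ a * (u * u) + b' * (2# * u) → a * t + b * 1# ≡ a * u + b' * 1# →
    b * ((t + - u) * (t + - u)) ≡ 0#
  tangents-meet⇒ a b b' t u e₀ e₁ e₂ = trans elimination (combine (x≡y⇒x-y≡0 e₀) (x≡y⇒x-y≡0 e₁) (x≡y⇒x-y≡0 e₂))
    where
    elimination : b * ((t + - u) * (t + - u)) ≡
      (a * (t * t * t) + b * (3# * t * t) + - (a * (u * u * u) + b' * (3# * u * u)))
      + - (3# * u * u * (a * t + b * 1# + - (a * u + b' * 1#)))
      + - ((t + 2# * u) * ((a * (t * t) + b * (2# * t) + - (a * (u * u) + b' * (2# * u))) + - (2# * u * (a * t + b * 1# + - (a * u + b' * 1#)))))
    elimination = solve 5 (λ a b b' t u → b :* ((t :+ :- u) :* (t :+ :- u)) :=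
      (a :* (t :* t :* t) :+ b :* (:3 :* t :* t) :+ :- (a :* (u :* u :* u) :+ b' :* (:3 :* u :* u)))
      :+ :- (:3 :* u :* u :* (a :* t :+ b :* :1 :+ :- (a :* u :+ b' :* :1)))
      :+ :- ((t :+ :2 :* u) :* ((a :* (t :* t) :+ b :* (:2 :* t) :+ :- (a :* (u :* u) :+ b' :* (:2 :* u)))
                                 :+ :- (:2 :* u :* (a :* t :+ b :* :1 :+ :- (a :* u :+ b' :* :1)))))) refl a b b' t u
    combine : ∀ {x y z} → x ≡ 0# → y ≡ 0# → z ≡ 0# → x + - (3# * u * u * z) + - ((t + 2# * u) * (y + - (2# * u * z))) ≡ 0#
    combine refl refl refl = solve 2 (λ t u → :0 :+ :- (:3 :* u :* u :* :0) :+ :- ((t :+ :2 :* u) :* (:0 :+ :- (:2 :* u :* :0))) := :0) refl t u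

  OnTangentAt-unique : ∀ X p r → X ≢ 𝟎v → ¬ InC X → OnTangentAt X p → OnTangentAt X r → p ≡ r
  OnTangentAt-unique X p r X≢0 X∉C (a , b , X≡) (a' , b' , X≡') =
    meet p r (OnTangentAt⇒off-C-coefficient≢0 {p = p} X≢0 X∉C X≡) (OnTangentAt⇒off-C-coefficient≢0 {p = r} X≢0 X∉C X≡') (trans (sym X≡) X≡')
    where
    x≡x*1+y*0 : ∀ x y → x ≡ x * 1# + y * 0#
    x≡x*1+y*0 x y = solve 2 (λ x y → x := x :* :1 :+ y :* :0) refl x y
    x*0+y*0≡0 : ∀ x y → x * 0# + y * 0# ≡ 0#
    x*0+y*0≡0 x y = solve 2 (λ x y → x :* :0 :+ y :* :0 := :0) refl x y
    x*t+y*1≡0⇒ : ∀ {x y} t → x ≡ 0# → x * t + y * 1# ≡ 0# → y ≡ 0#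
    x*t+y*1≡0⇒ {y = y} t refl eq = trans (sym (*-identityʳ y)) (trans (sym (0*x+y≡y t _)) eq)
    meet : ∀ p r → b ≢ 0# → b' ≢ 0# → (a ⊙ point p) ⊕ (b ⊙ tangentVec p) ≡ (a' ⊙ point r) ⊕ (b' ⊙ tangentVec r) → p ≡ r
    meet (fin t) (fin u) b≢0 _ eq with t ≟ u | trans (x≡x*1+y*0 a b) (trans (cong π₃ eq) (sym (x≡x*1+y*0 a' b')))
    ... | yes t≡u | _ = cong fin t≡u
    ... | no t≢u | refl = [ (λ b≡0 → ⊥-elim (b≢0 b≡0)) , (λ [t-u]²≡0 → ⊥-elim (t≢u (x-y≡0⇒x≡y (x²≡0⇒x≡0 [t-u]²≡0)))) ]′
                            (zero-product (tangents-meet⇒ a b b' t u (cong π₀ eq) (cong π₁ eq) (cong π₂ eq)))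
    meet (fin t) ∞ b≢0 _ eq = ⊥-elim (b≢0 (x*t+y*1≡0⇒ t a≡0 (trans (cong π₂ eq) (x*0+y*0≡0 a' b'))))
      where
      a≡0 : a ≡ 0#
      a≡0 = trans (x≡x*1+y*0 a b) (trans (cong π₃ eq) (x*0+y*0≡0 a' b'))
    meet ∞ (fin u) _ b'≢0 eq = ⊥-elim (b'≢0 (x*t+y*1≡0⇒ u a'≡0 (trans (sym (cong π₂ eq)) (x*0+y*0≡0 a b))))
      where
      a'≡0 : a' ≡ 0#
      a'≡0 = trans (x≡x*1+y*0 a' b') (trans (sym (cong π₃ eq)) (x*0+y*0≡0 a b))
    meet ∞ ∞ _ _ _ = refl

  Proj-pencilPlane⇒coefficients : ∀ p {l m l' m'} → Proj (pencilPlane p l m) (pencilPlane p l' m') →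
    Σ Carrier λ k → k ≢ 0# × l ≡ k * l' × m ≡ k * m'
  Proj-pencilPlane⇒coefficients p (k , k≢0 , eq) = k , k≢0 , pencilPlane-⊙⇒coefficients p eq

  pencilPlane-normalize : ∀ p l m (l≢0 : l ≢ 0#) → Proj (pencilPlane p l m) (pencilPlane p 1# (m * inv l l≢0))
  pencilPlane-normalize p l m l≢0 =
    l , l≢0 , trans (cong₂ (pencilPlane p) (sym (*-identityʳ l)) (y≡x*[y/x] l m l≢0)) (pencilPlane-scale p l 1# (m * inv l l≢0))

  NonOscCoefficient : Carrier → Carrier → Set
  NonOscCoefficient t e = e ≢ - (1# * t)

  NonOscCoefficient? : ∀ t e → Dec (NonOscCoefficient t e)
  NonOscCoefficient? t e = ¬? (e ≟ (- (1# * t)))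

  -- The q planes through the tangent at p other than its osculating plane, one representative each.
  twoCPlanesAt : ℙ¹ → List V
  twoCPlanesAt (fin t) = pencilPlane (fin t) 0# 1# ∷ map (pencilPlane (fin t) 1#) (filter (NonOscCoefficient? t) elems)
  twoCPlanesAt ∞ = map (pencilPlane ∞ 1#) elems

  length-twoCPlanesAt : ∀ p → length (twoCPlanesAt p) ≡ q F
  length-twoCPlanesAt (fin t) = trans (cong ℕ.suc (length-map (pencilPlane (fin t) 1#) (filter (NonOscCoefficient? t) elems)))
                                      (length-filter-≢ _≟_ elems unique (complete (- (1# * t))))
  length-twoCPlanesAt ∞ = length-map (pencilPlane ∞ 1#) elems

  pencilPlane-1-injective : ∀ p {e e'} → pencilPlane p 1# e ≡ pencilPlane p 1# e' → e ≡ e'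
  pencilPlane-1-injective p {e} {e'} eq =
    trans (sym (coefficient₂-pencilPlane p 1# e)) (trans (cong (coefficient₂ p) eq) (coefficient₂-pencilPlane p 1# e'))

  private
    1≡k*1⇒ : ∀ {k e e'} → 1# ≡ k * 1# → e ≡ k * e' → e ≡ e'
    1≡k*1⇒ {k} {e} {e'} 1≡k e≡ke' = trans e≡ke' (trans (cong (_* e') (trans (sym (*-identityʳ k)) (sym 1≡k))) (*-identityˡ e'))

    0≢k*1 : ∀ {k} → k ≢ 0# → 0# ≢ k * 1#
    0≢k*1 {k} k≢0 0≡k = k≢0 (trans (sym (*-identityʳ k)) (sym 0≡k))

    1≢k*0 : ∀ k → 1# ≢ k * 0#
    1≢k*0 k 1≡0 = 1≢0 (trans 1≡0 (zeroʳ k))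

  twoCPlanesAt-unique : ∀ p → Unique (twoCPlanesAt p)
  twoCPlanesAt-unique (fin t) = All.tabulate first-distinct
    ∷ Unique.map⁺ (pencilPlane-1-injective (fin t)) (Unique.filter⁺ (NonOscCoefficient? t) unique)
    where
    first-distinct : ∀ {x} → x ∈ map (pencilPlane (fin t) 1#) (filter (NonOscCoefficient? t) elems) → pencilPlane (fin t) 0# 1# ≢ x
    first-distinct x∈ eq with ∈-map⁻ (pencilPlane (fin t) 1#) x∈
    ... | e , _ , refl = 0≢1 (trans (sym (coefficient₁-pencilPlane (fin t) 0# 1#))
                                (trans (cong (coefficient₁ (fin t)) eq) (coefficient₁-pencilPlane (fin t) 1# e)))
  twoCPlanesAt-unique ∞ = Unique.map⁺ (pencilPlane-1-injective ∞) unique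

  Proj-pencilPlane-1⇒≡ : ∀ p {e e'} → Proj (pencilPlane p 1# e) (pencilPlane p 1# e') → pencilPlane p 1# e ≡ pencilPlane p 1# e'
  Proj-pencilPlane-1⇒≡ p a~b with Proj-pencilPlane⇒coefficients p a~b
  ... | _ , _ , 1≡k , e≡ke' = cong (pencilPlane p 1#) (1≡k*1⇒ 1≡k e≡ke')

  ¬Proj-pencilPlane-0-1 : ∀ p {e} → ¬ Proj (pencilPlane p 0# 1#) (pencilPlane p 1# e)
  ¬Proj-pencilPlane-0-1 p a~b with Proj-pencilPlane⇒coefficients p a~b
  ... | k , k≢0 , 0≡k , _ = 0≢k*1 k≢0 0≡k

  ¬Proj-pencilPlane-1-0 : ∀ p {e} → ¬ Proj (pencilPlane p 1# e) (pencilPlane p 0# 1#)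
  ¬Proj-pencilPlane-1-0 p a~b with Proj-pencilPlane⇒coefficients p a~b
  ... | k , _ , 1≡k0 , _ = 1≢k*0 k 1≡k0

  twoCPlanesAt-nonproportional : ∀ p a b → a ∈ twoCPlanesAt p → b ∈ twoCPlanesAt p → Proj a b → a ≡ b
  twoCPlanesAt-nonproportional (fin t) a b (here refl) (here refl) _ = refl
  twoCPlanesAt-nonproportional (fin t) a b (here refl) (there b∈) a~b with ∈-map⁻ (pencilPlane (fin t) 1#) b∈
  ... | _ , _ , refl = ⊥-elim (¬Proj-pencilPlane-0-1 (fin t) a~b)
  twoCPlanesAt-nonproportional (fin t) a b (there a∈) (here refl) a~b with ∈-map⁻ (pencilPlane (fin t) 1#) a∈
  ... | _ , _ , refl = ⊥-elim (¬Proj-pencilPlane-1-0 (fin t) a~b)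
  twoCPlanesAt-nonproportional (fin t) a b (there a∈) (there b∈) a~b
    with ∈-map⁻ (pencilPlane (fin t) 1#) a∈ | ∈-map⁻ (pencilPlane (fin t) 1#) b∈
  ... | _ , _ , refl | _ , _ , refl = Proj-pencilPlane-1⇒≡ (fin t) a~b
  twoCPlanesAt-nonproportional ∞ a b a∈ b∈ a~b with ∈-map⁻ (pencilPlane ∞ 1#) a∈ | ∈-map⁻ (pencilPlane ∞ 1#) b∈
  ... | _ , _ , refl | _ , _ , refl = Proj-pencilPlane-1⇒≡ ∞ a~b

  twoCPlanesAt-Two-C : ∀ p w → w ∈ twoCPlanesAt p → w ≢ 𝟎v × (TangentIn p w × Two-C w)
  twoCPlanesAt-Two-C (fin t) w (here refl) =
    pencilPlane-nonzero (fin t) 1≠0 , TangentIn-pencilPlane (fin t) 0# 1# , nCOnPlane-pencilPlane (fin t) 0# 1# 1≠0 (λ osc → proj₁ osc refl)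
    where
    1≠0 : NotBothZero 0# 1#
    1≠0 (_ , 1≡0) = 1≢0 1≡0
  twoCPlanesAt-Two-C (fin t) w (there w∈) with ∈-map⁻ (pencilPlane (fin t) 1#) w∈
  ... | e , e∈ , refl = pencilPlane-nonzero (fin t) 1≠0 , TangentIn-pencilPlane (fin t) 1# e ,
        nCOnPlane-pencilPlane (fin t) 1# e 1≠0 (λ osc → proj₂ (∈-filter⁻ (NonOscCoefficient? t) {xs = elems} e∈) (proj₂ osc))
    where
    1≠0 : NotBothZero 1# e
    1≠0 (1≡0 , _) = 1≢0 1≡0
  twoCPlanesAt-Two-C ∞ w w∈ with ∈-map⁻ (pencilPlane ∞ 1#) w∈
  ... | e , _ , refl = pencilPlane-nonzero ∞ 1≠0 , TangentIn-pencilPlane ∞ 1# e , nCOnPlane-pencilPlane ∞ 1# e 1≠0 1≢0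
    where
    1≠0 : NotBothZero 1# e
    1≠0 (1≡0 , _) = 1≢0 1≡0

  twoCPlanesAt-complete : ∀ p c → c ≢ 𝟎v → TangentIn p c × Two-C c → Any (Proj c) (twoCPlanesAt p)
  twoCPlanesAt-complete p c c≢0 (p⊆c , c-2C) with TangentIn⇒pencilPlane p c p⊆c
  ... | l , m , refl with OscCoefficients? p l m
  ...   | yes osc = ⊥-elim (osculating⇒¬Two-C p (OscCoefficients⇒osculating p l,m≢0 osc) c-2C)
    where
    l,m≢0 : NotBothZero l m
    l,m≢0 = nonzero⇒NotBothZero {p} c≢0 refl
  ...   | no ¬osc = find p ¬osc (nonzero⇒NotBothZero {p} c≢0 refl)
    where
    find : ∀ p → ¬ OscCoefficients p l m → NotBothZero l m → Any (Proj (pencilPlane p l m)) (twoCPlanesAt p)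
    find (fin t) ¬osc l,m≢0 with l ≟ 0#
    ... | yes refl = here (m , (λ m≡0 → l,m≢0 (refl , m≡0)) ,
                           trans (cong₂ (pencilPlane (fin t)) (sym (zeroʳ m)) (sym (*-identityʳ m))) (pencilPlane-scale (fin t) m 0# 1#))
    ... | no l≢0 = there (Any.map (λ { refl → pencilPlane-normalize (fin t) l m l≢0 })
                           (∈-map⁺ (pencilPlane (fin t) 1#) (∈-filter⁺ (NonOscCoefficient? t) (complete _) m/l≢-t)))
      where
      m/l≢-t : NonOscCoefficient t (m * inv l l≢0)
      m/l≢-t eq = ¬osc (l≢0 , trans (y≡x*[y/x] l m l≢0) (trans (cong (l *_) eq) (solve 2 (λ l t → l :* (:- (:1 :* t)) := :- (l :* t)) refl l t)))
    find ∞ l≢0 _ = Any.map (λ { refl → pencilPlane-normalize ∞ l m l≢0 }) (∈-map⁺ (pencilPlane ∞ 1#) (complete _))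

  module Two-CPlanesThrough (A B : V) =
    CountPoints (λ c → LineInPlane? A B c ×-dec Two-C? c) (λ c~d (A,B⊆d , d-2C) → LineInPlane-resp c~d A,B⊆d , Two-C-resp c~d d-2C)

  module OscPlanesThrough (A B : V) =
    CountPoints (λ c → LineInPlane? A B c ×-dec IsOsc? c) (λ c~d (A,B⊆d , d-osc) → LineInPlane-resp c~d A,B⊆d , IsOsc-resp c~d d-osc)

  Π-2C-tangent : ∀ p → Π-2C (point p) (tangentVec p) ≡ q F
  Π-2C-tangent p = trans (Two-CPlanesThrough.count-≡ (point p) (tangentVec p) (twoCPlanesAt p) (twoCPlanesAt-unique p)
    (twoCPlanesAt-nonproportional p) (twoCPlanesAt-Two-C p) (twoCPlanesAt-complete p)) (length-twoCPlanesAt p)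

  Π-osc-tangent : ∀ p → Π-osc (point p) (tangentVec p) ≡ 1
  Π-osc-tangent p = OscPlanesThrough.count-≡ (point p) (tangentVec p) (osculating p ∷ []) ([] ∷ []) single good cover
    where
    single : ∀ a b → a ∈ osculating p ∷ [] → b ∈ osculating p ∷ [] → Proj a b → a ≡ b
    single a b (here refl) (here refl) _ = refl
    good : ∀ w → w ∈ osculating p ∷ [] → w ≢ 𝟎v × (TangentIn p w × IsOsc w)
    good w (here refl) = osculating-nonzero p , TangentIn-osculating p , osculating⇒IsOsc p (Proj-refl _)
    cover : ∀ c → c ≢ 𝟎v → TangentIn p c × IsOsc c → Any (Proj c) (osculating p ∷ [])
    cover c c≢0 (p⊆c , c-osc) with IsOsc⇒osculating c-osc
    ... | r , c~r with TangentIn-unique r p c c≢0 (TangentIn-resp {p = r} c~r (TangentIn-osculating r)) p⊆c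
    ...   | refl = here c~r

  tangent-independent : ∀ p → Independent (point p) (tangentVec p)
  tangent-independent (fin t) k m eq =
    k≡0 , trans (sym (*-identityʳ m)) (trans (sym (0*x+y≡y t _)) (trans (cong (λ z → z * t + m * 1#) (sym k≡0)) (cong π₂ eq)))
    where
    k≡0 : k ≡ 0#
    k≡0 = trans (solve 2 (λ k m → k := k :* :1 :+ m :* :0) refl k m) (cong π₃ eq)
  tangent-independent ∞ k m eq = trans (solve 2 (λ k m → k := k :* :1 :+ m :* :0) refl k m) (cong π₀ eq) ,
                                 trans (solve 2 (λ k m → m := k :* :0 :+ m :* :1) refl k m) (cong π₁ eq)

  tangent-IsTangent : ∀ p → IsTangent (point p) (tangentVec p)
  tangent-IsTangent (fin t) = inj₁ (t , OnLine-first _ _ , OnLine-second _ _)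
  tangent-IsTangent ∞ = inj₂ (OnLine-first _ _ , OnLine-second _ _)

  IsOsc-or-Two-C⇒tangent : ∀ c → IsOsc c ⊎ Two-C c → Σ ℙ¹ λ p → TangentIn p c
  IsOsc-or-Two-C⇒tangent c (inj₁ c-osc) with IsOsc⇒osculating c-osc
  ... | p , c~p = p , TangentIn-resp {p = p} c~p (TangentIn-osculating p)
  IsOsc-or-Two-C⇒tangent c (inj₂ c-2C) = Two-C⇒tangent c c-2C

  param : Fin (ℕ.suc (q F)) → ℙ¹
  param Fin.zero = ∞
  param (Fin.suc i) = fin (lookup elems i)

  param-injective : ∀ i j → param i ≡ param j → i ≡ j
  param-injective Fin.zero Fin.zero _ = refl
  param-injective (Fin.suc i) (Fin.suc j) eq = cong Fin.suc (lookup-injective elems unique i j (fin-injective eq))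

  param-surjective : ∀ p → Σ (Fin (ℕ.suc (q F))) λ i → param i ≡ p
  param-surjective ∞ = Fin.zero , refl
  param-surjective (fin t) = Fin.suc (Any.index (complete t)) , cong fin (sym (lookup-index (complete t)))

  osculating-tangentPoint : ∀ s t a b → dot (oscPl s) ((a ⊙ curvePt t) ⊕ (b ⊙ tangentDir t))
    ≡ a * ((t + - s) * (t + - s) * (t + - s)) + 3# * (b * ((t + - s) * (t + - s)))
  osculating-tangentPoint = solve 4 (λ s t a b → dotᴾ (oscPlᴾ s) ((a ⊙ᴾ curvePtᴾ t) ⊕ᴾ (b ⊙ᴾ tangentDirᴾ t))
    := a :* ((t -ᴾ s) :* (t -ᴾ s) :* (t -ᴾ s)) :+ :3 :* (b :* ((t -ᴾ s) :* (t -ᴾ s)))) refl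
  osculating∞-tangentPoint : ∀ t a b → dot oscInf ((a ⊙ curvePt t) ⊕ (b ⊙ tangentDir t)) ≡ a
  osculating∞-tangentPoint = solve 3 (λ t a b → dotᴾ oscInfᴾ ((a ⊙ᴾ curvePtᴾ t) ⊕ᴾ (b ⊙ᴾ tangentDirᴾ t)) := a) refl
  osculating-tangent∞Point : ∀ s a b → dot (oscPl s) ((a ⊙ curveInf) ⊕ (b ⊙ tangentDirInf)) ≡ a + 3# * (- (s * b))
  osculating-tangent∞Point = solve 3 (λ s a b → dotᴾ (oscPlᴾ s) ((a ⊙ᴾ curveInfᴾ) ⊕ᴾ (b ⊙ᴾ tangentDirInfᴾ)) := a :+ :3 :* (:- (s :* b))) refl

  module _ (3≡0 : 3# ≡ 0#) where
    private
      x+3y≡x : ∀ x y → x + 3# * y ≡ x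
      x+3y≡x x y = x+0≡x (trans (cong (_* y) 3≡0) (zeroˡ y))

    osculating-through-tangentPoint : ∀ p r a b → OnPlane ((a ⊙ point p) ⊕ (b ⊙ tangentVec p)) (osculating r) → r ≡ p ⊎ a ≡ 0#
    osculating-through-tangentPoint (fin t) (fin s) a b on =
      [ inj₂ , (λ [t-s]³≡0 → inj₁ (cong fin (sym (x-y≡0⇒x≡y (x³≡0⇒x≡0 [t-s]³≡0))))) ]′
      (zero-product (trans (sym (x+3y≡x _ _)) (trans (sym (osculating-tangentPoint s t a b)) on)))
    osculating-through-tangentPoint (fin t) ∞ a b on = inj₂ (trans (sym (osculating∞-tangentPoint t a b)) on)
    osculating-through-tangentPoint ∞ (fin s) a b on = inj₂ (trans (sym (x+3y≡x _ _)) (trans (sym (osculating-tangent∞Point s a b)) on))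
    osculating-through-tangentPoint ∞ ∞ a b on = inj₁ refl

    tangentPoint-on-axis : ∀ p b → π₀ ((0# ⊙ point p) ⊕ (b ⊙ tangentVec p)) ≡ 0# × π₃ ((0# ⊙ point p) ⊕ (b ⊙ tangentVec p)) ≡ 0#
    tangentPoint-on-axis (fin t) b =
      trans (cong (λ z → 0# * (t * t * t) + b * (z * t * t)) 3≡0) (solve 2 (λ t b → :0 :* (t :* t :* t) :+ b :* (:0 :* t :* t) := :0) refl t b) ,
      solve 1 (λ b → :0 :* :1 :+ b :* :0 := :0) refl b
    tangentPoint-on-axis ∞ b = solve 1 (λ b → :0 :* :1 :+ b :* :0 := :0) refl b , solve 1 (λ b → :0 :* :0 :+ b :* :0 := :0) refl b

-- If 3 ≠ 0 in F, then σ (x , y) = (y , - (x + y)) has order 3 and fixes only (0 , 0), so its orbits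
-- split the q² - 1 nonzero pairs into triples; since q² - 1 ≡ 2 (mod 3) when 3 ∣ q, this is impossible.
module Characteristic3 (F : FiniteField) where
  open FiniteField F
  open Geom F using (3#; ∃?)
  open FieldProperties F

  Pair : Set
  Pair = Carrier × Carrier

  σ : Pair → Pair
  σ (x , y) = y , - (x + y)

  σ³≡id : ∀ z → σ (σ (σ z)) ≡ z
  σ³≡id (x , y) = cong₂ _,_ (solve 2 (λ x y → :- (y :+ :- (x :+ y)) := x) refl x y)
                            (solve 2 (λ x y → :- (:- (x :+ y) :+ :- (y :+ :- (x :+ y))) := y) refl x y)

  σ-origin : σ (0# , 0#) ≡ (0# , 0#)
  σ-origin = cong (0# ,_) (solve 0 (:- (:0 :+ :0) := :0) refl)

  σ-fixed⇒origin : 3# ≢ 0# → ∀ z → σ z ≡ z → z ≡ (0# , 0#)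
  σ-fixed⇒origin 3≢0 (x , y) σz≡z with cong proj₁ σz≡z
  ... | refl = cong₂ _,_ x≡0 x≡0
    where
    3x≡0 : 3# * x ≡ 0#
    3x≡0 = trans (solve 1 (λ x → :3 :* x := x :+ :- (:- (x :+ x))) refl x) (trans (cong (λ z → x + - z) (cong proj₂ σz≡z)) (-‿inverseʳ x))
    x≡0 : x ≡ 0#
    x≡0 with zero-product 3x≡0
    ... | inj₁ 3≡0 = ⊥-elim (3≢0 3≡0)
    ... | inj₂ x≡0 = x≡0

  3∣q⇒3≡0 : q F % 3 ≡ 0 → 3# ≡ 0#
  3∣q⇒3≡0 q%3≡0 with 3# ≟ 0#
  ... | yes 3≡0 = 3≡0
  ... | no 3≢0 = ⊥-elim (3≢1 (∣1⇒≡1 (∣m+n∣m⇒∣n (subst (3 ∣_) q²≡ (∣m⇒∣m*n (q F) (m%n≡0⇒n∣m (q F) 3 q%3≡0))) 3∣nonzero)))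
    where
    _≟²_ : DecidableEquality Pair
    _≟²_ = ≡-dec _≟_ _≟_
    pairs nonzero : List Pair
    pairs = cartesianProduct elems elems
    nonzero = filter (λ z → ¬? (z ≟² (0# , 0#))) pairs
    pairs! : Unique pairs
    pairs! = Unique.cartesianProduct⁺ unique unique
    ∈nonzero⁻ : ∀ {z} → z ∈ nonzero → z ∈ pairs × z ≢ (0# , 0#)
    ∈nonzero⁻ = ∈-filter⁻ (λ z → ¬? (z ≟² (0# , 0#))) {xs = pairs}
    σ-closed : ∀ z → z ∈ nonzero → σ z ∈ nonzero
    σ-closed z z∈ = ∈-filter⁺ (λ z → ¬? (z ≟² (0# , 0#))) (∈-cartesianProduct⁺ (complete _) (complete _))
      (λ σz≡0 → proj₂ (∈nonzero⁻ z∈) (trans (sym (σ³≡id z)) (trans (cong (λ w → σ (σ w)) σz≡0) (trans (cong σ σ-origin) σ-origin))))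
    3∣nonzero : 3 ∣ length nonzero
    3∣nonzero = FixedPointFreeOrder3.3∣length _≟²_ σ σ³≡id (length nonzero) nonzero ℕ.≤-refl
      (Unique.filter⁺ (λ z → ¬? (z ≟² (0# , 0#))) pairs!) σ-closed (λ z z∈ σz≡z → proj₂ (∈nonzero⁻ z∈) (σ-fixed⇒origin 3≢0 z σz≡z))
    q²≡ : q F ℕ.* q F ≡ length nonzero ℕ.+ 1
    q²≡ = trans (sym (length-cartesianProduct elems elems))
           (trans (sym (length-filter-≢ _≟²_ pairs pairs! (∈-cartesianProduct⁺ (complete 0#) (complete 0#)))) (ℕ.+-comm 1 (length nonzero)))
    3≢1 : 3 ≢ 1
    3≢1 ()

  -- In characteristic 3, (a - b)³ = a³ - b³, so cubing is injective and hence surjective.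
  cube-surjective : 3# ≡ 0# → ∀ y → Σ Carrier λ s → s * s * s ≡ y
  cube-surjective 3≡0 y with ∃? (λ s → (s * s * s) ≟ y)
  ... | yes found = found
  ... | no none = ⊥-elim (ℕ.<-irrefl refl (ℕ.≤-trans (ℕ.≤-reflexive (length-filter-≢ _≟_ elems unique (complete y))) cubes-miss-y))
    where
    cube-injective : ∀ a b → a * a * a ≡ b * b * b → a ≡ b
    cube-injective a b a³≡b³ = x-y≡0⇒x≡y (x³≡0⇒x≡0 (trans
      (solve 2 (λ a b → (a :+ :- b) :* (a :+ :- b) :* (a :+ :- b) := (a :* a :* a :+ :- (b :* b :* b)) :+ :3 :* (a :* b :* b :+ :- (a :* a :* b))) refl a b)
      (trans (cong₂ (λ u v → u + v * (a * b * b + - (a * a * b))) (x≡y⇒x-y≡0 a³≡b³) 3≡0) (trans (cong (0# +_) (zeroˡ _)) (+-identityʳ 0#)))))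
    cubes-miss-y : length elems ℕ.≤ length (filter (λ z → ¬? (z ≟ y)) elems)
    cubes-miss-y = length-≤-injection _≟_ elems (filter (λ z → ¬? (z ≟ y)) elems) unique (λ x _ → x * x * x)
      (λ x _ → ∈-filter⁺ (λ z → ¬? (z ≟ y)) (complete _) (λ x³≡y → none (x , x³≡y))) (λ a b _ _ → cube-injective a b)

module LineOffC (F : FiniteField) (A B : Geom.V F) (A,B-independent : Geom.Independent F A B)
                (no-point-of-C : ¬ Geom.MeetsC F A B) (in-no-osculating : ¬ Geom.InOscPlane F A B) where
  open FiniteField F
  open Geom F
  open FieldProperties F
  open ProjectiveSpace F
  open TwistedCubic F
  open Syntax using (dotᴾ)

  OnLine⇒∉C : ∀ {X} → OnLine X A B → ¬ InC X
  OnLine⇒∉C {X} X∈ℓ X∈C = no-point-of-C (X , X∈C , X∈ℓ)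

  nonzero-combination⇒NotBothZero : ∀ {X k m} → X ≢ 𝟎v → X ≡ (k ⊙ A) ⊕ (m ⊙ B) → NotBothZero k m
  nonzero-combination⇒NotBothZero X≢0 refl (refl , refl) = X≢0 (combination-zero A B)

  NotBothZero⇒combination-nonzero : ∀ {k m} → NotBothZero k m → (k ⊙ A) ⊕ (m ⊙ B) ≢ 𝟎v
  NotBothZero⇒combination-nonzero {k} {m} k,m≢0 eq = k,m≢0 (A,B-independent k m eq)

  -- The plane spanned by the line and a tangent it meets: it cannot be osculating, so it is a 2_C-plane.
  plane-through-tangent : ∀ X p → X ≢ 𝟎v → OnLine X A B → OnTangentAt X p →
    Σ V λ c → c ≢ 𝟎v × Two-C c × LineInPlane A B c × TangentIn p c
  plane-through-tangent X p X≢0 (k , m , X≡) X∈p = plane (kernel⇒left-kernel _ _ _ _ k m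
    (X∈N (N₁ p) (TangentIn-N₁ p)) (X∈N (N₂ p) (TangentIn-N₂ p)) (nonzero-combination⇒NotBothZero X≢0 X≡))
    where
    X∈N : ∀ N → TangentIn p N → k * dot N A + m * dot N B ≡ 0#
    X∈N N p⊆N = trans (sym (dot-combinationʳ N k A m B)) (trans (cong (dot N) (sym X≡)) (OnLine⇒OnPlane X∈p p⊆N))
    plane : (Σ Carrier λ l → Σ Carrier λ n → NotBothZero l n × l * dot (N₁ p) A + n * dot (N₂ p) A ≡ 0#
                                                              × l * dot (N₁ p) B + n * dot (N₂ p) B ≡ 0#) →
            Σ V λ c → c ≢ 𝟎v × Two-C c × LineInPlane A B c × TangentIn p c
    plane (l , n , l,n≢0 , A∈ , B∈) =
      [ (λ c~osc → ⊥-elim (in-no-osculating (pencilPlane p l n , osculating⇒IsOsc p c~osc , ℓ⊆c)))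
      , (λ c-2C → pencilPlane p l n , pencilPlane-nonzero p l,n≢0 , c-2C , ℓ⊆c , TangentIn-pencilPlane p l n) ]′
      (pencilPlane-osculating-or-Two-C p l n l,n≢0)
      where
      ℓ⊆c : LineInPlane A B (pencilPlane p l n)
      ℓ⊆c = trans (dot-pencilPlane p l n A) A∈ , trans (dot-pencilPlane p l n B) B∈

  -- Two points of the line on one tangent coincide; otherwise the line would be that tangent and meet C.
  same-tangent⇒Proj : ∀ {X Y p} → X ≢ 𝟎v → Y ≢ 𝟎v → OnLine X A B → OnLine Y A B → OnTangentAt X p → OnTangentAt Y p → Proj X Y
  same-tangent⇒Proj {X} {Y} {p} X≢0 Y≢0 X∈ℓ Y∈ℓ (a , b , X≡) (a' , b' , Y≡) = by-det ((a * b' + - (a' * b)) ≟ 0#)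
    where
    by-det : Dec (a * b' + - (a' * b) ≡ 0#) → Proj X Y
    by-det (no det≢0) = ⊥-elim (no-point-of-C (_ , point⇒InC p (_ , det≢0 , point-combination) , OnLine-combination b' (- b) X∈ℓ Y∈ℓ))
      where
      point-combination : (b' ⊙ X) ⊕ ((- b) ⊙ Y) ≡ (a * b' + - (a' * b)) ⊙ point p
      point-combination = trans (cong₂ (λ u v → (b' ⊙ u) ⊕ ((- b) ⊙ v)) X≡ Y≡) (combination-eliminate a b a' b' (point p) (tangentVec p))
    by-det (yes det≡0) = Proj-⊙ (OnTangentAt⇒off-C-coefficient≢0 {p = p} Y≢0 (OnLine⇒∉C Y∈ℓ) Y≡)
                                (OnTangentAt⇒off-C-coefficient≢0 {p = p} X≢0 (OnLine⇒∉C X∈ℓ) X≡)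
                                (trans (cong (b' ⊙_) X≡) (trans (combination-det≡0 a b a' b' (point p) (tangentVec p) det≡0) (cong (b ⊙_) (sym Y≡))))

  TPointOn : V → Set
  TPointOn X = OnLine X A B × TPoint X

  TPointOn-resp : ∀ {X Y} → Proj X Y → TPointOn Y → TPointOn X
  TPointOn-resp X~Y (Y∈ℓ , Y≢0 , Y∉C , Y-tangent) =
    OnLine-resp X~Y Y∈ℓ , Proj-nonzero X~Y Y≢0 , (λ X∈C → Y∉C (InC-resp (Proj-sym X~Y) X∈C)) ,
    OnTangentAt⇒OnTangent (proj₁ Y∈p) (OnLine-resp X~Y (proj₂ Y∈p))
    where
    Y∈p : Σ ℙ¹ (OnTangentAt _)
    Y∈p = OnTangent⇒OnTangentAt Y-tangent

  Two-CPlaneThrough : V → Set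
  Two-CPlaneThrough c = LineInPlane A B c × Two-C c

  -- A point X of the line and a plane c through the line correspond when c contains a tangent through X;
  -- this is a bijection between the T-points of the line and the 2_C-planes through it.
  Corresponding : V → V → Set
  Corresponding X c = X ≢ 𝟎v × c ≢ 𝟎v × OnLine X A B × LineInPlane A B c × Σ ℙ¹ λ p → OnTangentAt X p × TangentIn p c

  TPoint⇒plane : ∀ X → X ≢ 𝟎v → TPointOn X → Σ V λ c → c ≢ 𝟎v × Two-CPlaneThrough c × Corresponding X c
  TPoint⇒plane X X≢0 (X∈ℓ , _ , _ , X-tangent) = from-tangent (OnTangent⇒OnTangentAt X-tangent)
    where
    from-tangent : Σ ℙ¹ (OnTangentAt X) → Σ V λ c → c ≢ 𝟎v × Two-CPlaneThrough c × Corresponding X c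
    from-tangent (p , X∈p) = let (c , c≢0 , c-2C , ℓ⊆c , p⊆c) = plane-through-tangent X p X≢0 X∈ℓ X∈p
                             in c , c≢0 , (ℓ⊆c , c-2C) , X≢0 , c≢0 , X∈ℓ , ℓ⊆c , p , X∈p , p⊆c

  plane-determines-TPoint : ∀ X Y c d → Corresponding X c → Corresponding Y d → Proj c d → Proj X Y
  plane-determines-TPoint X Y c d (X≢0 , c≢0 , X∈ℓ , _ , p , X∈p , p⊆c) (Y≢0 , _ , Y∈ℓ , _ , r , Y∈r , r⊆d) c~d =
    same-tangent⇒Proj {p = p} X≢0 Y≢0 X∈ℓ Y∈ℓ X∈p
      (subst (OnTangentAt Y) (sym (TangentIn-unique p r c c≢0 p⊆c (TangentIn-resp {p = r} c~d r⊆d))) Y∈r)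

  P-T≤Π-2C : P-T A B ≤ Π-2C A B
  P-T≤Π-2C = count-≤-via (λ X → OnLine? X A B ×-dec TPoint? X) (λ c → LineInPlane? A B c ×-dec Two-C? c)
    (λ c~d (ℓ⊆d , d-2C) → LineInPlane-resp c~d ℓ⊆d , Two-C-resp c~d d-2C) Corresponding
    TPoint⇒plane (λ X Y c d _ _ _ _ → plane-determines-TPoint X Y c d)

  plane-through-tangent⇒point : ∀ c p → c ≢ 𝟎v → LineInPlane A B c → TangentIn p c → Σ V λ X → X ≢ 𝟎v × OnLine X A B × OnTangentAt X p
  plane-through-tangent⇒point c p c≢0 (A∈c , B∈c) p⊆c = from-pencil (TangentIn⇒pencilPlane p c p⊆c)
    where
    from-pencil : (Σ Carrier λ l → Σ Carrier λ m → c ≡ pencilPlane p l m) → Σ V λ X → X ≢ 𝟎v × OnLine X A B × OnTangentAt X p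
    from-pencil (l , m , refl) = from-kernel (kernel⇒left-kernel _ _ _ _ l m (trans (sym (dot-pencilPlane p l m A)) A∈c)
                                         (trans (sym (dot-pencilPlane p l m B)) B∈c) (nonzero⇒NotBothZero {p} c≢0 refl))
      where
      from-kernel : (Σ Carrier λ k → Σ Carrier λ n → NotBothZero k n × k * dot (N₁ p) A + n * dot (N₁ p) B ≡ 0#
                                                             × k * dot (N₂ p) A + n * dot (N₂ p) B ≡ 0#) →
              Σ V λ X → X ≢ 𝟎v × OnLine X A B × OnTangentAt X p
      from-kernel (k , n , k,n≢0 , X∈N₁ , X∈N₂) = (k ⊙ A) ⊕ (n ⊙ B) , NotBothZero⇒combination-nonzero k,n≢0 , (k , n , refl) ,
        N₁∩N₂⇒OnTangentAt p _ (trans (dot-combinationʳ (N₁ p) k A n B) X∈N₁) (trans (dot-combinationʳ (N₂ p) k A n B) X∈N₂)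

  Two-C-plane⇒TPoint : ∀ c → c ≢ 𝟎v → Two-CPlaneThrough c → Σ V λ X → X ≢ 𝟎v × TPointOn X × Corresponding X c
  Two-C-plane⇒TPoint c c≢0 (ℓ⊆c , c-2C) = from-tangent (Two-C⇒tangent c c-2C)
    where
    from-tangent : Σ ℙ¹ (λ p → TangentIn p c) → Σ V λ X → X ≢ 𝟎v × TPointOn X × Corresponding X c
    from-tangent (p , p⊆c) = let (X , X≢0 , X∈ℓ , X∈p) = plane-through-tangent⇒point c p c≢0 ℓ⊆c p⊆c
      in X , X≢0 , (X∈ℓ , X≢0 , OnLine⇒∉C X∈ℓ , OnTangentAt⇒OnTangent p X∈p) , X≢0 , c≢0 , X∈ℓ , ℓ⊆c , p , X∈p , p⊆c

  -- Two distinct planes through the tangent at p containing the line would force the whole pencil,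
  -- in particular the osculating plane at p, to contain the line.
  planes-through-tangent-Proj : ∀ c d p → c ≢ 𝟎v → d ≢ 𝟎v → LineInPlane A B c → LineInPlane A B d → TangentIn p c → TangentIn p d → Proj c d
  planes-through-tangent-Proj c d p c≢0 d≢0 (A∈c , B∈c) (A∈d , B∈d) p⊆c p⊆d =
    from-pencils (TangentIn⇒pencilPlane p c p⊆c) (TangentIn⇒pencilPlane p d p⊆d)
    where
    from-pencils : (Σ Carrier λ l → Σ Carrier λ m → c ≡ pencilPlane p l m) → (Σ Carrier λ l → Σ Carrier λ m → d ≡ pencilPlane p l m) → Proj c d
    from-pencils (l , m , refl) (l' , m' , refl) = by-det ((l * m' + - (l' * m)) ≟ 0#)
      where
      by-det : Dec (l * m' + - (l' * m) ≡ 0#) → Proj (pencilPlane p l m) (pencilPlane p l' m')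
      by-det (no det≢0) = ⊥-elim (in-no-osculating (osculating p , osculating⇒IsOsc p (Proj-refl _) , in-pencil A A∈c A∈d , in-pencil B B∈c B∈d))
        where
        in-pencil : ∀ Z → OnPlane Z (pencilPlane p l m) → OnPlane Z (pencilPlane p l' m') → OnPlane Z (osculating p)
        in-pencil Z Z∈c Z∈d =
          let (Z∈N₁ , Z∈N₂) = det≢0⇒trivial-kernel (trans (sym (dot-pencilPlane p l m Z)) Z∈c)
                                                    (trans (sym (dot-pencilPlane p l' m' Z)) Z∈d) det≢0
          in trans (cong (λ e → dot e Z) (osculating≡pencilPlane p)) (trans (dot-pencilPlane p _ _ Z) (linear-zero _ _ Z∈N₁ Z∈N₂))
      by-det (yes det≡0) =
        let (κ , κ≢0 , l'≡ , m'≡) = det≡0⇒proportional (nonzero⇒NotBothZero {p} c≢0 refl) (nonzero⇒NotBothZero {p} d≢0 refl) det≡0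
        in Proj-sym (κ , κ≢0 , trans (cong₂ (pencilPlane p) l'≡ m'≡) (pencilPlane-scale p κ l m))

  TPoint-determines-plane : ∀ X Y c d → Corresponding X c → Corresponding Y d → Proj X Y → Proj c d
  TPoint-determines-plane X Y c d (X≢0 , c≢0 , X∈ℓ , ℓ⊆c , p , X∈p , p⊆c) (_ , d≢0 , _ , ℓ⊆d , r , Y∈r , r⊆d) X~Y =
    planes-through-tangent-Proj c d p c≢0 d≢0 ℓ⊆c ℓ⊆d p⊆c (subst (λ s → TangentIn s d) (sym p≡r) r⊆d)
    where
    p≡r : p ≡ r
    p≡r = OnTangentAt-unique X p r X≢0 (OnLine⇒∉C X∈ℓ) X∈p (OnLine-resp X~Y Y∈r)

  Π-2C≤P-T : Π-2C A B ≤ P-T A B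
  Π-2C≤P-T = count-≤-via (λ c → LineInPlane? A B c ×-dec Two-C? c) (λ X → OnLine? X A B ×-dec TPoint? X)
    TPointOn-resp (λ c X → Corresponding X c) Two-C-plane⇒TPoint (λ c d X Y _ _ _ _ → TPoint-determines-plane X Y c d)

  P-T≡Π-2C : P-T A B ≡ Π-2C A B
  P-T≡Π-2C = ℕ.≤-antisym P-T≤Π-2C Π-2C≤P-T

  module _ (3≡0 : 3# ≡ 0#) where
    open Characteristic3 F using (cube-surjective)

    -- In characteristic 3 every plane x₀ = κ x₃ through the line x₀ = x₃ = 0 is osculating (cubing is onto),
    -- so our line cannot meet that line.
    on-axis⇒⊥ : ∀ X → X ≢ 𝟎v → OnLine X A B → π₀ X ≡ 0# → π₃ X ≡ 0# → ⊥
    on-axis⇒⊥ X X≢0 (k , m , refl) x₀≡0 x₃≡0 =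
      from-left-kernel (kernel⇒left-kernel (π₀ A) (π₃ A) (π₀ B) (π₃ B) k m x₀≡0 x₃≡0 (nonzero-combination⇒NotBothZero X≢0 refl))
      where
      from-left-kernel : (Σ Carrier λ l → Σ Carrier λ n → NotBothZero l n × l * π₀ A + n * π₃ A ≡ 0# × l * π₀ B + n * π₃ B ≡ 0#) → ⊥
      from-left-kernel (l , n , l,n≢0 , A∈ , B∈) = in-no-osculating (e , e-osc , trans (dot-e A) A∈ , trans (dot-e B) B∈)
        where
        e : V
        e = l , 0# , 0# , n
        dot-e : ∀ Y → dot e Y ≡ l * π₀ Y + n * π₃ Y
        dot-e Y = solve 6 (λ l n y₀ y₁ y₂ y₃ → dotᴾ (l , :0 , :0 , n) (y₀ , y₁ , y₂ , y₃) := l :* y₀ :+ n :* y₃)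
                          refl l n (π₀ Y) (π₁ Y) (π₂ Y) (π₃ Y)
        e-osc : IsOsc e
        e-osc with l ≟ 0#
        ... | yes refl = inj₂ (n , (λ n≡0 → l,n≢0 (refl , n≡0)) , ≡⁴ (sym (zeroʳ n)) (sym (zeroʳ n)) (sym (zeroʳ n)) (sym (*-identityʳ n)))
        ... | no l≢0 = let (s , s³≡) = cube-surjective 3≡0 (- (n * inv l l≢0)) in
          inj₁ (s , l , l≢0 , ≡⁴ (sym (*-identityʳ l)) (vanish (λ z → - (z * s)) (solve 2 (λ l s → l :* (:- (:0 :* s)) := :0) refl l s))
                                  (vanish (λ z → z * s * s) (solve 2 (λ l s → l :* (:0 :* s :* s) := :0) refl l s))
                                  (sym (trans (cong (λ z → l * (- z)) s³≡) (trans (cong (l *_) (⁻¹-involutive _)) (sym (y≡x*[y/x] l n l≢0))))))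
          where
          vanish : ∀ (f : Carrier → Carrier) → l * f 0# ≡ 0# → 0# ≡ l * f 3#
          vanish f l*f0≡0 = sym (trans (cong (λ z → l * f z) 3≡0) l*f0≡0)

    module OscPlanesThroughPoint (X : V) =
      CountPoints (λ c → IsOsc? c ×-dec OnPlane? X c) (λ c~d (d-osc , X∈d) → IsOsc-resp c~d d-osc , OnPlane-respʳ c~d X∈d)

    nOscThroughPt≡1 : ∀ X p → X ≢ 𝟎v → OnLine X A B → OnTangentAt X p → nOscThroughPt X ≡ 1
    nOscThroughPt≡1 X p X≢0 X∈ℓ X∈p@(a , b , X≡) =
      OscPlanesThroughPoint.count-≡ X (osculating p ∷ []) ([] ∷ []) single good cover
      where
      single : ∀ u v → u ∈ osculating p ∷ [] → v ∈ osculating p ∷ [] → Proj u v → u ≡ v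
      single u v (here refl) (here refl) _ = refl
      good : ∀ w → w ∈ osculating p ∷ [] → w ≢ 𝟎v × (IsOsc w × OnPlane X w)
      good w (here refl) = osculating-nonzero p , osculating⇒IsOsc p (Proj-refl _) , OnLine⇒OnPlane X∈p (TangentIn-osculating p)
      cover : ∀ c → c ≢ 𝟎v → IsOsc c × OnPlane X c → Any (Proj c) (osculating p ∷ [])
      cover c _ (c-osc , X∈c) = from-osculating (IsOsc⇒osculating c-osc)
        where
        from-osculating : (Σ ℙ¹ λ r → Proj c (osculating r)) → Any (Proj c) (osculating p ∷ [])
        from-osculating (r , c~r) =
          [ (λ { refl → here c~r })
          , (λ { refl → ⊥-elim (on-axis⇒⊥ X X≢0 X∈ℓ (trans (cong π₀ X≡) (proj₁ (tangentPoint-on-axis 3≡0 p b)))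
                                                     (trans (cong π₃ X≡) (proj₂ (tangentPoint-on-axis 3≡0 p b)))) }) ]′
          (osculating-through-tangentPoint 3≡0 p r a b (subst (λ Z → OnPlane Z (osculating r)) X≡ (OnPlane-respʳ (Proj-sym c~r) X∈c)))

module TangentPencils (F : FiniteField) where
  open Geom F
  open TwistedCubic F

  axis : Fin (suc (q F)) → V × V
  axis i = point (param i) , tangentVec (param i)

  pencil-partition : ∀ c → c ≢ 𝟎v → IsOsc c ⊎ Two-C c →
    ∃ λ i → LineInPlane (proj₁ (axis i)) (proj₂ (axis i)) c × (∀ j → LineInPlane (proj₁ (axis j)) (proj₂ (axis j)) c → j ≡ i)
  pencil-partition c c≢0 c-osc-or-2C =
    let (p , p⊆c) = IsOsc-or-Two-C⇒tangent c c-osc-or-2C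
        (i , param-i≡p) = param-surjective p
    in i , subst (λ r → TangentIn r c) (sym param-i≡p) p⊆c ,
       λ j j⊆c → param-injective j i (trans (TangentIn-unique (param j) p c c≢0 j⊆c p⊆c) (sym param-i≡p))

module EnGLines (F : FiniteField) (Ext : QuadExt F) where
  open Geom F
  open ExtGeom Ext
  open TwistedCubic F
  open Characteristic3 F using (3∣q⇒3≡0)

  EnG-meets-tangent : ∀ A B → Independent A B → EnG A B →
    ∀ X → X ≢ 𝟎v → OnLine X A B → OnTangent X →
      (∃ λ c → c ≢ 𝟎v × Two-C c × LineInPlane A B c) × (q F % 3 ≢ 0 → TPoint X) × (q F % 3 ≡ 0 → TOPoint X)
  EnG-meets-tangent A B A,B-independent (∉C , ∉osc , _) X X≢0 X∈ℓ X-tangent =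
    let (p , X∈p) = OnTangent⇒OnTangentAt X-tangent
        (c , c≢0 , c-2C , ℓ⊆c , _) = plane-through-tangent X p X≢0 X∈ℓ X∈p
        X-T = X≢0 , OnLine⇒∉C X∈ℓ , X-tangent
    in (c , c≢0 , c-2C , ℓ⊆c) , (λ _ → X-T) , (λ 3∣q → X-T , nOscThroughPt≡1 (3∣q⇒3≡0 3∣q) X p X≢0 X∈ℓ X∈p)
    where open LineOffC F A B A,B-independent ∉C ∉osc

  EnG-counts : ∀ A B → Independent A B → EnG A B →
    (q F % 3 ≢ 0 → P-T A B ≡ Π-2C A B) × (q F % 3 ≡ 0 → P-TO A B ≡ Π-2C A B)
  EnG-counts A B A,B-independent (∉C , ∉osc , _) = (λ _ → P-T≡Π-2C) , (λ 3∣q → trans (P-TO≡P-T 3∣q) P-T≡Π-2C)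
    where
    open LineOffC F A B A,B-independent ∉C ∉osc
    P-TO≡P-T : q F % 3 ≡ 0 → P-TO A B ≡ P-T A B
    P-TO≡P-T 3∣q = cong length (filter-≐ (λ X → OnLine? X A B ×-dec TOPoint? X) (λ X → OnLine? X A B ×-dec TPoint? X)
      ((λ (X∈ℓ , X-T , _) → X∈ℓ , X-T) ,
       (λ {X} (X∈ℓ , X-T@(X≢0 , _ , X-tangent)) → X∈ℓ , X-T ,
          nOscThroughPt≡1 (3∣q⇒3≡0 3∣q) X (proj₁ (OnTangent⇒OnTangentAt X-tangent)) X≢0 X∈ℓ (proj₂ (OnTangent⇒OnTangentAt X-tangent))))
      points)

mainTheorem6 : (F : FiniteField) (Ext : QuadExt F) → 5 ≤ q F →
    let open Geom F
        open ExtGeom Ext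
    in
    -- (i) pencils with tangent axes partitioning osculating and 2_C-planes
    (Σ (Fin (suc (q F)) → V × V) λ ax →
        (∀ i → Independent (proj₁ (ax i)) (proj₂ (ax i))
             × IsTangent (proj₁ (ax i)) (proj₂ (ax i))
             × Π-osc (proj₁ (ax i)) (proj₂ (ax i)) ≡ 1
             × Π-2C (proj₁ (ax i)) (proj₂ (ax i)) ≡ q F
             × (∀ c → c ≢ 𝟎v → LineInPlane (proj₁ (ax i)) (proj₂ (ax i)) c → IsOsc c ⊎ Two-C c))
      × (∀ c → c ≢ 𝟎v → IsOsc c ⊎ Two-C c →
           ∃ λ i → LineInPlane (proj₁ (ax i)) (proj₂ (ax i)) c
                 × (∀ j → LineInPlane (proj₁ (ax j)) (proj₂ (ax j)) c → j ≡ i)))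
    -- (ii) EnG-lines meeting tangents
    × (∀ A B → Independent A B → EnG A B →
         ∀ X → X ≢ 𝟎v → OnLine X A B → OnTangent X →
           (∃ λ c → c ≢ 𝟎v × Two-C c × LineInPlane A B c)
           × (q F % 3 ≢ 0 → TPoint X)
           × (q F % 3 ≡ 0 → TOPoint X))
    -- (iii) counting
    × (∀ A B → Independent A B → EnG A B →
           (q F % 3 ≢ 0 → P-T A B ≡ Π-2C A B)
           × (q F % 3 ≡ 0 → P-TO A B ≡ Π-2C A B))
mainTheorem6 F Ext _ =
  (axis , (λ i → tangent-independent (param i) , tangent-IsTangent (param i) , Π-osc-tangent (param i) ,
                 Π-2C-tangent (param i) , TangentIn⇒IsOsc-or-Two-C (param i)) , pencil-partition) ,
  EnG-meets-tangent , EnG-counts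
  where
  open TwistedCubic F
  open TangentPencils F
  open EnGLines F Ext
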